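{- If an $\mathbf S$-braid arrangement $\mathcal A_{\mathbf S}$ has Property X and Property Y, then the generalized Pak–Stanley labeling $\lambda:R(\mathcal A_{\mathbf S})\to\mathrm{Park}_{\mathbf S}$ is bijective.
   Context: Fix $n\ge1$, $[n]=\{1,\dots,n\}$. $H_{i,j,s}=\{x\in\mathbb R^n:x_i-x_j=s\}$. For finite sets of integers $\mathbf S=(S_{i,j})_{1\le i<j\le n}$, $\mathcal A_{\mathbf S}=\{H_{i,j,s}:i<j,\ s\in S_{i,j}\}$ with set of regions $R(\mathcal A_{\mathbf S})$. For $i<j$: $S^+_{i,j}=\{s>0:s\in S_{i,j}\}$, $S^+_{j,i}=\{s\ge0:-s\in S_{i,j}\}$; $S^+_{i,i}=\emptyset$. Property X: for all $i<j$ in $[n]$, all $k\in[n]\setminus\{i,j\}$, and every $s\in S^+_{j,k}$, either $s\in S^+_{i,k}$ or ($s=0$ and $i<k$). Property Y: for all pairwise distinct $i,j,k\in[n]$ and every integer $s\ge0$ with $s>0$ or $j<i$: if $s\notin S^+_{i,j}$ then $s+t\notin S^+_{k,j}$ for all $t>0$. $D_{\mathbf S}$: multigraph on $[n+1]$ with $|S^+_{i,j}|$ arcs $(i,j)$ for each $i\ne j$ in $[n]$ and one arc $(i,n+1)$ for each $i\in[n]$; $p\in\mathbb Z^n_{\ge0}$ is a $D_{\mathbf S}$-parking function if every nonempty $U\subseteq[n]$ has $u\in U$ with $p_u<$ number of arcs $(u,v)$ with $v\notin U$; $\mathrm{Park}_{\mathbf S}$ is their set. GPS labeling: with $R_0$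 the region of $\mathcal A_{\mathbf S}$ containing $\{x_1>\dots>x_n>x_1-1\}$, $\lambda(R)=(p_1,\dots,p_n)$ where $p_i$ is the number of pairs $(j,s)$, $j\in[n]$, $s\in S^+_{i,j}$, such that $H_{i,j,s}$ separates $R$ from $R_0$. -}

module Defs where

open import Data.Nat as ℕ using (ℕ; zero; suc; _+_)
open import Data.Integer as ℤ using (ℤ; +_; -[1+_])
import Data.Integer.Properties as ℤP
open import Data.Rational as ℚ using (ℚ; _/_)
import Data.Rational.Properties as ℚP
open import Data.Fin using (Fin; zero; suc; toℕ; inject₁; _<_)
import Data.Fin.Properties as FinP
open import Data.Fin.Subset using (Subset; _∈_; _∉_; Nonempty)
open import Data.Vec using (lookup)
open import Data.Nat.ListAction using (sum)
open import Data.List using (List; []; _∷_; length; map; mapMaybe; filter; deduplicate; allFin)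
import Data.List.Membership.Propositional as LM
open import Data.Maybe using (Maybe; just; nothing)
import Data.Maybe as Maybe
open import Data.Bool using (Bool; true; false; if_then_else_; _∧_; _∨_)
open import Data.Product using (Σ; ∃; ∃-syntax; _×_; _,_)
open import Data.Sum using (_⊎_)
open import Relation.Nullary using (¬_; does)
open import Relation.Binary using (Tri; tri<; tri≈; tri>)
open import Relation.Binary.PropositionalEquality using (_≡_; _≢_)
open import Function.Bundles using (_⇔_)

-- Data of an S-braid arrangement: S i j is a finite set (list) of
-- integers; only the entries with i < j are used.

Family : ℕ → Set
Family n = Fin n → Fin n → List ℤ

-- S⁺_{a,b} as a duplicate-free list of naturals.
--  a < b : { s > 0 : s ∈ S_{a,b} }
--  b < a : { s ≥ 0 : -s ∈ S_{b,a} }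
--  a = b : ∅
posPart : ℤ → Maybe ℕ
posPart (+ zero)  = nothing
posPart (+ suc m) = just (suc m)
posPart -[1+ m ]  = nothing

nonposPart : ℤ → Maybe ℕ
nonposPart (+ zero)  = just zero
nonposPart (+ suc m) = nothing
nonposPart -[1+ m ]  = just (suc m)

S⁺ : ∀ {n} → Family n → Fin n → Fin n → List ℕ
S⁺ S a b with FinP.<-cmp a b
... | tri< _ _ _ = mapMaybe posPart (deduplicate ℤP._≟_ (S a b))
... | tri≈ _ _ _ = []
... | tri> _ _ _ = mapMaybe nonposPart (deduplicate ℤP._≟_ (S b a))

_∈S⁺[_,_,_] : ∀ {n} → ℕ → Family n → Fin n → Fin n → Set
s ∈S⁺[ S , a , b ] = s LM.∈ S⁺ S a b

PropertyX : ∀ {n} → Family n → Set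
PropertyX {n} S = ∀ (i j k : Fin n) → i < j → k ≢ i → k ≢ j →
  ∀ (s : ℕ) → s ∈S⁺[ S , j , k ] →
  (s ∈S⁺[ S , i , k ]) ⊎ (s ≡ 0 × i < k)

PropertyY : ∀ {n} → Family n → Set
PropertyY {n} S = ∀ (i j k : Fin n) → i ≢ j → i ≢ k → j ≢ k →
  ∀ (s : ℕ) → (0 ℕ.< s ⊎ j < i) → ¬ (s ∈S⁺[ S , i , j ]) →
  ∀ (t : ℕ) → 0 ℕ.< t → ¬ ((s + t) ∈S⁺[ S , k , j ])

-- The multigraph D_S on [n+1] (vertex n+1 is the last element of
-- Fin (suc n)), given by arc multiplicities, and D-parking functions.

vertex : ∀ {n} → Fin (suc n) → Maybe (Fin n)
vertex {zero}  zero    = nothing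
vertex {suc n} zero    = just zero
vertex {suc n} (suc i) = Maybe.map suc (vertex i)

arcsD : ∀ {n} → Family n → Fin (suc n) → Fin (suc n) → ℕ
arcsD S u v with vertex u | vertex v
... | just i  | just j  = length (S⁺ S i j)
... | just i  | nothing = 1
... | nothing | _       = 0

inU : ∀ {n} → Subset n → Fin (suc n) → Bool
inU U v with vertex v
... | just w  = lookup U w
... | nothing = false

outArcs : ∀ {n} → (Fin (suc n) → Fin (suc n) → ℕ) → Subset n → Fin n → ℕ
outArcs {n} D U u =
  sum (map (λ v → if inU U v then 0 else D (inject₁ u) v) (allFin (suc n)))

IsParking : ∀ {n} → (Fin (suc n) → Fin (suc n) → ℕ) → (Fin n → ℕ) → Set
IsParking {n} D p = ∀ (U : Subset n) → Nonempty U →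
  ∃[ u ] (u ∈ U × p u ℕ.< outArcs D U u)

Park : ∀ {n} → Family n → (Fin n → ℕ) → Set
Park S p = IsParking (arcsD S) p

-- Regions of A_S, represented by rational points off all hyperplanes
-- (every region is open, nonempty, hence contains rational points).

Point : ℕ → Set
Point n = Fin n → ℚ

diff : ∀ {n} → Point n → Fin n → Fin n → ℚ
diff x i j = x i ℚ.- x j

ℤ→ℚ : ℤ → ℚ
ℤ→ℚ z = z / 1

ℕ→ℚ : ℕ → ℚ
ℕ→ℚ m = (+ m) / 1

Generic : ∀ {n} → Family n → Point n → Set
Generic {n} S x = ∀ (i j : Fin n) → i < j → ∀ (s : ℤ) → s LM.∈ S i j →
  diff x i j ≢ ℤ→ℚ s

SameRegion : ∀ {n} → Family n → Point n → Point n → Set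
SameRegion {n} S x y = ∀ (i j : Fin n) → i < j → ∀ (s : ℤ) → s LM.∈ S i j →
  (diff x i j ℚ.< ℤ→ℚ s) ⇔ (diff y i j ℚ.< ℤ→ℚ s)

separates : ∀ {n} → Point n → Point n → Fin n → Fin n → ℚ → Bool
separates x y i j c =
  (does (diff x i j ℚP.<? c) ∧ does (c ℚP.<? diff y i j)) ∨
  (does (c ℚP.<? diff x i j) ∧ does (diff y i j ℚP.<? c))

-- a point of R₀ ⊇ {x₁ > ⋯ > x_n > x₁ - 1}: x_k = -(k-1)/(n+1)
basePoint : ∀ n → Point n
basePoint n i = ℚ.- ((+ toℕ i) / suc n)

label : ∀ {n} → Family n → Point n → Fin n → ℕ
label {n} S x i =
  sum (map (λ j → length (filter (λ s → separates x (basePoint n) i j (ℕ→ℚ s) Data.Bool.≟ true)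
                                 (S⁺ S i j)))
           (allFin n))
  where import Data.Bool

-- A region is represented by a generic rational point x in it, whose label counts, for each i,
-- the s ∈ S⁺_{i,j} with s < x_i − x_j. The vertex of a set U with least coordinate crosses no
-- hyperplane towards U, which gives the parking condition. For injectivity, two generic points
-- x, z with the same label are compared along decreasing x − z: Properties X and Y give a
-- triangle rule for S⁺ forcing every count of crossed hyperplanes H_{i,j,·} to agree, and equal
-- counts of crossed thresholds mean the same side of every hyperplane. For surjectivity, the
-- vertices are placed greedily from left to right; each step places the largest vertex that has
-- just collected its prescribed label, the parking condition guaranteeing that one always does,
-- and halving the step each time keeps the point off every hyperplane.

module Submission where

open import Defs
open import Data.Nat using (ℕ; _≤_)
open import Data.Fin using (Fin)
open import Data.Product using (Σ; ∃; ∃-syntax; _×_)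
open import Relation.Binary.PropositionalEquality using (_≡_)

open import Data.Bool using (Bool; true; false; not; if_then_else_)
import Data.Bool as Bool
open import Data.Bool.Properties using (∧-zeroʳ; ∧-identityʳ; not-involutive; ¬-not)
open import Data.Empty using (⊥; ⊥-elim)
open import Data.Fin as Fin using (zero; suc; toℕ; inject₁; fromℕ)
import Data.Fin.Properties as FinP
open import Data.Fin.Subset using (Subset)
import Data.Fin.Subset as Subset
open import Data.Integer as ℤ using (ℤ; +_; -[1+_]; +<+)
import Data.Integer.Properties as ℤP
open import Data.List using (List; []; _∷_; length; filter; map; mapMaybe; deduplicate; allFin; tabulate)
import Data.List.Properties as ListP
open import Data.List.Membership.Propositional using (_∈_)
open import Data.List.Membership.Propositional.Properties using (∈-allFin; ∈-deduplicate⁻; ∈-deduplicate⁺)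
open import Data.List.Relation.Unary.Any using (here; there)
import Data.List.Relation.Unary.All as All
open import Data.List.Relation.Unary.AllPairs using ([]; _∷_)
open import Data.List.Relation.Unary.Unique.Propositional using (Unique)
open import Data.List.Relation.Unary.Unique.DecPropositional.Properties using (deduplicate-!)
open import Data.Maybe using (Maybe; just; nothing)
import Data.Maybe as Maybe
open import Data.Nat as ℕ using (zero; suc; z≤n; s≤s; z<s; _+_; _*_; _∸_; _^_; _<_; _≤?_; _<?_; _≟_; NonZero)
open import Data.Nat.Divisibility using (_∣_; divides; ∣-trans; ∣-refl; n∣m*n; m∣m*n; ∣m∣n⇒∣m+n; _∣0)
open import Data.Nat.Induction using (<-wellFounded)
open import Data.Nat.ListAction using (sum)
import Data.Nat.Properties as ℕP
open import Algebra.Properties.CommutativeSemigroup ℕP.+-commutativeSemigroup using () renaming (interchange to +-interchange)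
open import Data.List.Membership.DecPropositional ℕP._≟_ using (_∈?_)
open import Data.Product using (∃₂; _,_; proj₁; proj₂; map₁; map₂)
open import Data.Rational as ℚ using (ℚ; _/_; 0ℚ; toℚᵘ)
import Data.Rational.Properties as ℚP
open import Data.Rational.Solver using (module +-*-Solver)
open import Data.Rational.Unnormalised as ℚᵘ using (mkℚᵘ; *≡*; *<*)
import Data.Rational.Unnormalised.Properties as ℚᵘP
open import Data.Sum using (_⊎_; inj₁; inj₂; [_,_]; [_,_]′)
import Data.Sum as Sum
open import Data.Vec using (lookup)
import Data.Vec as Vec
import Data.Vec.Properties as VecP
open import Data.Vec.Functional using (updateAt)
open import Data.Vec.Functional.Properties using (updateAt-updates; updateAt-minimal)
open import Function using (_∘_; id; const)
open import Function.Bundles using (_⇔_; mk⇔; Equivalence)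
open import Function.Properties.Equivalence using () renaming (sym to ⇔-sym)
open import Induction.WellFounded using (Acc; acc)
open import Level using (Level)
open import Relation.Binary using (Rel; Total; Transitive; Tri; tri<; tri≈; tri>)
open import Relation.Binary.PropositionalEquality hiding ([_])
open import Relation.Nullary using (¬_; yes; no; Dec; does; _×-dec_)
open import Relation.Nullary.Decidable using (dec-true; dec-false)
open import Relation.Unary using (Pred; Decidable)

open Equivalence using (to; from)
open +-*-Solver

private variable
  a p q r : Level
  A : Set a
  m n : ℕ

∑ : (Fin n → ℕ) → ℕ
∑ {zero}  f = 0
∑ {suc n} f = f zero + ∑ (f ∘ suc)

∑-cong : {f g : Fin n → ℕ} → (∀ i → f i ≡ g i) → ∑ f ≡ ∑ g
∑-cong {n = zero}  f≡g = refl
∑-cong {n = suc n} f≡g = cong₂ _+_ (f≡g zero) (∑-cong (f≡g ∘ suc))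

∑-mono-≤ : {f g : Fin n → ℕ} → (∀ i → f i ≤ g i) → ∑ f ≤ ∑ g
∑-mono-≤ {n = zero}  f≤g = z≤n
∑-mono-≤ {n = suc n} f≤g = ℕP.+-mono-≤ (f≤g zero) (∑-mono-≤ (f≤g ∘ suc))

∑-mono-< : {f g : Fin n → ℕ} → (∀ i → f i ≤ g i) → ∀ k → f k < g k → ∑ f < ∑ g
∑-mono-< {n = suc n} f≤g zero    fk<gk = ℕP.+-mono-<-≤ fk<gk (∑-mono-≤ (f≤g ∘ suc))
∑-mono-< {n = suc n} f≤g (suc k) fk<gk = ℕP.+-mono-≤-< (f≤g zero) (∑-mono-< (f≤g ∘ suc) k fk<gk)

∑-+ : (f g : Fin n → ℕ) → ∑ (λ i → f i + g i) ≡ ∑ f + ∑ g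
∑-+ {n = zero}  f g = refl
∑-+ {n = suc n} f g =
  trans (cong (_+_ (f zero + g zero)) (∑-+ (f ∘ suc) (g ∘ suc))) (+-interchange (f zero) (g zero) _ _)

∑<∑⇒∃< : {f g : Fin n → ℕ} → ∑ f < ∑ g → ∃[ j ] f j < g j
∑<∑⇒∃< {f = f} {g = g} ∑f<∑g with FinP.any? (λ j → f j <? g j)
... | yes found = found
... | no none = ⊥-elim (ℕP.<⇒≱ ∑f<∑g (∑-mono-≤ (λ j → ℕP.≮⇒≥ (λ gj<fj → none (j , gj<fj)))))

∑≡∑⇒≡ : {f g : Fin n → ℕ} → (∀ i → f i ≤ g i) → ∑ f ≡ ∑ g → ∀ i → f i ≡ g i
∑≡∑⇒≡ f≤g ∑f≡∑g i with ℕP.m≤n⇒m<n∨m≡n (f≤g i)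
... | inj₁ fi<gi = ⊥-elim (ℕP.<-irrefl ∑f≡∑g (∑-mono-< f≤g i fi<gi))
... | inj₂ fi≡gi = fi≡gi

∑≡∑⇒∃> : {f g : Fin n → ℕ} → ∑ f ≡ ∑ g → ∀ k → f k < g k → ∃[ j ] g j < f j
∑≡∑⇒∃> {f = f} {g = g} ∑f≡∑g k fk<gk with FinP.any? (λ j → g j <? f j)
... | yes found = found
... | no none = ⊥-elim (ℕP.<-irrefl ∑f≡∑g (∑-mono-< (λ j → ℕP.≮⇒≥ (λ gj<fj → none (j , gj<fj))) k fk<gk))

∑-zero : {f : Fin n → ℕ} → (∀ i → f i ≡ 0) → ∑ f ≡ 0
∑-zero {n = zero}  f≡0 = refl
∑-zero {n = suc n} f≡0 = cong₂ _+_ (f≡0 zero) (∑-zero (f≡0 ∘ suc))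

∑-term : (f : Fin n → ℕ) → ∀ i → f i ≤ ∑ f
∑-term f zero    = ℕP.m≤m+n (f zero) _
∑-term f (suc i) = ℕP.≤-trans (∑-term (f ∘ suc) i) (ℕP.m≤n+m _ (f zero))

∑-≤1 : {f : Fin n → ℕ} → (∀ i → f i ≤ 1) → (∀ i j → 0 < f i → 0 < f j → i ≡ j) → ∑ f ≤ 1
∑-≤1 {n = zero}  f≤1 unique = z≤n
∑-≤1 {n = suc n} {f} f≤1 unique with f zero in f0
... | zero  = ∑-≤1 (f≤1 ∘ suc) (λ i j fi fj → FinP.suc-injective (unique (suc i) (suc j) fi fj))
... | suc k = subst (λ r → suc k + r ≤ 1) (sym (∑-zero rest≡0))
                (ℕP.≤-trans (ℕP.≤-reflexive (ℕP.+-identityʳ (suc k))) (subst (_≤ 1) f0 (f≤1 zero)))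
  where
  rest≡0 : ∀ i → f (suc i) ≡ 0
  rest≡0 i = ℕP.n≤0⇒n≡0 (ℕP.≮⇒≥ (λ fi → FinP.0≢1+n (unique zero (suc i) (subst (0 <_) (sym f0) z<s) fi)))

∑-const : ∀ n → ∑ {n} (λ _ → 1) ≡ n
∑-const zero    = refl
∑-const (suc n) = cong suc (∑-const n)

∑-allFin : (f : Fin n → ℕ) → sum (map f (allFin n)) ≡ ∑ f
∑-allFin f = trans (cong sum (ListP.map-tabulate id f)) (sum-tabulate f)
  where
  sum-tabulate : (g : Fin m → ℕ) → sum (tabulate g) ≡ ∑ g
  sum-tabulate {zero}  g = refl
  sum-tabulate {suc m} g = cong (_+_ (g zero)) (sum-tabulate (g ∘ suc))

∑-init-last : (f : Fin (suc n) → ℕ) → ∑ f ≡ ∑ (f ∘ inject₁) + f (fromℕ n)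
∑-init-last {zero}  f = ℕP.+-identityʳ (f zero)
∑-init-last {suc n} f = trans (cong (_+_ (f zero)) (∑-init-last (f ∘ suc))) (sym (ℕP.+-assoc (f zero) _ _))

_↾_ : (Fin n → Bool) → (Fin n → ℕ) → Fin n → ℕ
(U ↾ f) j = if U j then f j else 0

size : (Fin n → Bool) → ℕ
size U = ∑ (U ↾ λ _ → 1)

↾-cong : ∀ (U : Fin n → Bool) {f g} → (∀ j → U j ≡ true → f j ≡ g j) → ∀ j → (U ↾ f) j ≡ (U ↾ g) j
↾-cong U f≡g j with U j in Uj
... | true  = f≡g j Uj
... | false = refl

↾-mono-≤ : ∀ (U : Fin n → Bool) {f g} → (∀ j → U j ≡ true → f j ≤ g j) → ∀ j → (U ↾ f) j ≤ (U ↾ g) j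
↾-mono-≤ U f≤g j with U j in Uj
... | true  = f≤g j Uj
... | false = z≤n

↾-true : ∀ (U : Fin n → Bool) f {j} → U j ≡ true → (U ↾ f) j ≡ f j
↾-true U f Uj rewrite Uj = refl

↾-<⇒∈ : ∀ (U : Fin n → Bool) f g {j} → (U ↾ f) j < (U ↾ g) j → U j ≡ true × f j < g j
↾-<⇒∈ U f g {j} lt with U j
... | true  = refl , lt
... | false = ⊥-elim (ℕP.<-irrefl refl lt)

↾-pos⇒∈ : ∀ (U : Fin n → Bool) f {j} → 0 < (U ↾ f) j → U j ≡ true × 0 < f j
↾-pos⇒∈ U f {j} pos with U j
... | true  = refl , pos
... | false = ⊥-elim (ℕP.<-irrefl refl pos)

↾-+ : ∀ (U : Fin n → Bool) f g j → (U ↾ (λ k → f k + g k)) j ≡ (U ↾ f) j + (U ↾ g) j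
↾-+ U f g j with U j
... | true  = refl
... | false = refl

∑-single : ∀ (i : Fin n) f → ∑ ((λ j → does (j FinP.≟ i)) ↾ f) ≡ f i
∑-single {suc n} zero f = trans (cong (_+_ (f zero)) (∑-zero {n} (λ _ → refl))) (ℕP.+-identityʳ (f zero))
∑-single (suc i) f = ∑-single i (f ∘ suc)

∑↾-split : ∀ (U V : Fin n → Bool) u f → U u ≡ true → V u ≡ false → (∀ j → j ≢ u → U j ≡ V j) →
  ∑ (U ↾ f) ≡ ∑ (V ↾ f) + f u
∑↾-split U V u f Uu Vu U≡V = begin
  ∑ (U ↾ f)                                        ≡⟨ ∑-cong split ⟩
  ∑ (λ j → (V ↾ f) j + ((λ j → does (j FinP.≟ u)) ↾ f) j) ≡⟨ ∑-+ (V ↾ f) _ ⟩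
  ∑ (V ↾ f) + ∑ ((λ j → does (j FinP.≟ u)) ↾ f)    ≡⟨ cong (_+_ (∑ (V ↾ f))) (∑-single u f) ⟩
  ∑ (V ↾ f) + f u                                  ∎
  where
  open ≡-Reasoning
  split : ∀ j → (U ↾ f) j ≡ (V ↾ f) j + ((λ j → does (j FinP.≟ u)) ↾ f) j
  split j with j FinP.≟ u
  ... | yes refl rewrite Uu | Vu = refl
  ... | no j≢u rewrite U≡V j j≢u = sym (ℕP.+-identityʳ _)

_─_ : (Fin n → Bool) → Fin n → Fin n → Bool
U ─ i = updateAt U i (const false)

─-⊆ : ∀ (U : Fin n → Bool) {i j} → (U ─ i) j ≡ true → U j ≡ true
─-⊆ U {i} {j} j∈ with j FinP.≟ i
... | yes refl = ⊥-elim (false≢true (trans (sym (updateAt-updates i U)) j∈))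
  where
  false≢true : false ≢ true
  false≢true ()
... | no j≢i = trans (sym (updateAt-minimal j i U j≢i)) j∈

size-─ : ∀ (U : Fin n → Bool) {i} → U i ≡ true → size U ≡ suc (size (U ─ i))
size-─ U {i} i∈U = trans
  (∑↾-split U (U ─ i) i (λ _ → 1) i∈U (updateAt-updates i U) (λ j j≢i → sym (updateAt-minimal j i U j≢i)))
                         (ℕP.+-comm _ 1)

count : {P : Pred A p} → Decidable P → List A → ℕ
count P? xs = length (filter P? xs)

module _ {P : Pred A p} {Q : Pred A q} (P? : Decidable P) (Q? : Decidable Q) where

  count-mono : ∀ {xs} → (∀ {x} → x ∈ xs → P x → Q x) → count P? xs ≤ count Q? xs
  count-mono {[]}     P⇒Q = z≤n
  count-mono {x ∷ xs} P⇒Q with P? x | Q? x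
  ... | yes _  | yes _  = s≤s (count-mono (P⇒Q ∘ there))
  ... | yes px | no ¬qx = ⊥-elim (¬qx (P⇒Q (here refl) px))
  ... | no _   | yes _  = ℕP.m≤n⇒m≤1+n (count-mono (P⇒Q ∘ there))
  ... | no _   | no _   = count-mono (P⇒Q ∘ there)

  count-mono-< : ∀ {xs y} → (∀ {x} → x ∈ xs → P x → Q x) → y ∈ xs → ¬ P y → Q y →
    count P? xs < count Q? xs
  count-mono-< {x ∷ xs} P⇒Q (here refl) ¬py qy with P? x | Q? x
  ... | yes py | _      = ⊥-elim (¬py py)
  ... | no _   | yes _  = s≤s (count-mono (P⇒Q ∘ there))
  ... | no _   | no ¬qy = ⊥-elim (¬qy qy)
  count-mono-< {x ∷ xs} P⇒Q (there y∈xs) ¬py qy with P? x | Q? x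
  ... | yes _  | yes _  = s≤s (count-mono-< (P⇒Q ∘ there) y∈xs ¬py qy)
  ... | yes px | no ¬qx = ⊥-elim (¬qx (P⇒Q (here refl) px))
  ... | no _   | yes _  = ℕP.m<n⇒m<1+n (count-mono-< (P⇒Q ∘ there) y∈xs ¬py qy)
  ... | no _   | no _   = count-mono-< (P⇒Q ∘ there) y∈xs ¬py qy

  count<count⇒∃ : ∀ {xs} → count P? xs < count Q? xs → ∃[ x ] (x ∈ xs × ¬ P x × Q x)
  count<count⇒∃ {x ∷ xs} lt with P? x | Q? x
  ... | no ¬px | yes qx = x , here refl , ¬px , qx
  ... | yes _  | yes _  = map₂ (map₁ there) (count<count⇒∃ (ℕP.≤-pred lt))
  ... | yes _  | no _   = map₂ (map₁ there) (count<count⇒∃ (ℕP.<-trans (ℕP.n<1+n _) lt))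
  ... | no _   | no _   = map₂ (map₁ there) (count<count⇒∃ lt)

count-cong : {P : Pred A p} {Q : Pred A q} (P? : Decidable P) (Q? : Decidable Q) →
  ∀ {xs} → (∀ {x} → x ∈ xs → P x → Q x) → (∀ {x} → x ∈ xs → Q x → P x) →
  count P? xs ≡ count Q? xs
count-cong P? Q? P⇒Q Q⇒P = ℕP.≤-antisym (count-mono P? Q? P⇒Q) (count-mono Q? P? Q⇒P)

module _ {P : Pred A p} (P? : Decidable P) where

  count-none : ∀ {xs} → (∀ {x} → x ∈ xs → ¬ P x) → count P? xs ≡ 0
  count-none ¬P = cong length (ListP.filter-none P? (All.tabulate ¬P))

  count-all : ∀ {xs} → (∀ {x} → x ∈ xs → P x) → count P? xs ≡ length xs
  count-all allP = cong length (ListP.filter-all P? (All.tabulate allP))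

  count-pos⇒∃ : ∀ {xs} → 0 < count P? xs → ∃[ x ] (x ∈ xs × P x)
  count-pos⇒∃ {x ∷ xs} pos with P? x
  ... | yes px = x , here refl , px
  ... | no _ with count-pos⇒∃ pos
  ...   | y , y∈xs , py = y , there y∈xs , py

  count-≤1 : ∀ {xs} → Unique xs → (∀ {x y} → P x → P y → x ≡ y) → count P? xs ≤ 1
  count-≤1 {[]}     _ _ = z≤n
  count-≤1 {x ∷ xs} (x∉xs ∷ unique) P-unique with P? x
  ... | no _   = count-≤1 unique P-unique
  ... | yes px = s≤s (ℕP.≤-reflexive (count-none (λ y∈xs py → All.lookup x∉xs y∈xs (P-unique px py))))

  count-split : {Q : Pred A q} {R : Pred A r} (Q? : Decidable Q) (R? : Decidable R) →
    ∀ {xs} → (∀ {x} → x ∈ xs → P x → Q x ⊎ R x) → count P? xs ≤ count Q? xs + count R? xs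
  count-split Q? R? {[]}     _ = z≤n
  count-split Q? R? {x ∷ xs} P⇒Q⊎R with P? x | Q? x | R? x | count-split Q? R? (P⇒Q⊎R ∘ there)
  ... | no _   | no _  | no _  | ih = ih
  ... | no _   | no _  | yes _ | ih = ℕP.≤-trans ih (ℕP.+-monoʳ-≤ _ (ℕP.n≤1+n _))
  ... | no _   | yes _ | no _  | ih = ℕP.m≤n⇒m≤1+n ih
  ... | no _   | yes _ | yes _ | ih = ℕP.≤-trans ih (ℕP.+-mono-≤ (ℕP.n≤1+n _) (ℕP.n≤1+n _))
  ... | yes px | no ¬q | no ¬r | _  = ⊥-elim ([ ¬q , ¬r ] (P⇒Q⊎R (here refl) px))
  ... | yes _  | no _  | yes _ | ih = ℕP.≤-trans (s≤s ih) (ℕP.≤-reflexive (sym (ℕP.+-suc _ _)))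
  ... | yes _  | yes _ | no _  | ih = s≤s ih
  ... | yes _  | yes _ | yes _ | ih = s≤s (ℕP.≤-trans ih (ℕP.+-monoʳ-≤ _ (ℕP.n≤1+n _)))

module _ {A : Set a} (_≼_ : Rel A r) (≼-total : Total _≼_) (≼-trans : Transitive _≼_) where

  private
    ≼-refl : ∀ {x} → x ≼ x
    ≼-refl {x} = [ id , id ] (≼-total x x)

  argmin : {P : Pred (Fin n) p} → Decidable P → (f : Fin n → A) → ∃ P →
    ∃[ i ] (P i × ∀ {j} → P j → f i ≼ f j)
  argmin {suc n} {P = P} P? f (i , pi) with FinP.any? (P? ∘ suc)
  ... | no ∄suc = zero , P-zero i pi , λ { {zero} _ → ≼-refl ; {suc j} pj → ⊥-elim (∄suc (j , pj)) }
    where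
    P-zero : ∀ i → P i → P zero
    P-zero zero    p0 = p0
    P-zero (suc i) pi = ⊥-elim (∄suc (i , pi))
  ... | yes ∃suc with argmin (P? ∘ suc) (f ∘ suc) ∃suc | P? zero
  ...   | m , pm , min | no ¬p0 = suc m , pm , λ { {zero} p0 → ⊥-elim (¬p0 p0) ; {suc j} pj → min pj }
  ...   | m , pm , min | yes p0 with ≼-total (f zero) (f (suc m))
  ...     | inj₁ f0≼fm = zero , p0 , λ { {zero} _ → ≼-refl ; {suc j} pj → ≼-trans f0≼fm (min pj) }
  ...     | inj₂ fm≼f0 = suc m , pm , λ { {zero} _ → fm≼f0 ; {suc j} pj → min pj }

least : {P : Pred ℕ p} → Decidable P → ∀ m k → P (m + k) →
  ∃[ t ] (m ≤ t × P t × ∀ {t′} → m ≤ t′ → t′ < t → ¬ P t′)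
least {P = P} P? m k pm+k with P? m
... | yes pm = m , ℕP.≤-refl , pm , λ m≤t′ t′<m → ⊥-elim (ℕP.<⇒≱ t′<m m≤t′)
least {P = P} P? m zero    pm+0 | no ¬pm = ⊥-elim (¬pm (subst P (ℕP.+-identityʳ m) pm+0))
least {P = P} P? m (suc k) pm+k | no ¬pm with least P? (suc m) k (subst P (ℕP.+-suc m k) pm+k)
... | t , m<t , pt , below = t , ℕP.<⇒≤ m<t , pt , earlier
  where
  earlier : ∀ {t′} → m ≤ t′ → t′ < t → ¬ P t′
  earlier m≤t′ t′<t with ℕP.m≤n⇒m<n∨m≡n m≤t′
  ... | inj₁ m<t′ = below m<t′ t′<t
  ... | inj₂ refl = ¬pm

module _ {A B : Set} (f : A → Maybe B) where

  ∈-mapMaybe⁻ : ∀ xs {y} → y ∈ mapMaybe f xs → ∃[ x ] (x ∈ xs × f x ≡ just y)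
  ∈-mapMaybe⁻ (x ∷ xs) y∈ with f x in fx | y∈
  ... | nothing | y∈′        = let z , z∈ , fz = ∈-mapMaybe⁻ xs y∈′ in z , there z∈ , fz
  ... | just _  | here refl  = x , here refl , fx
  ... | just _  | there y∈′  = let z , z∈ , fz = ∈-mapMaybe⁻ xs y∈′ in z , there z∈ , fz

  ∈-mapMaybe⁺ : ∀ {xs x y} → x ∈ xs → f x ≡ just y → y ∈ mapMaybe f xs
  ∈-mapMaybe⁺ {x ∷ _} (here refl) fx rewrite fx = here refl
  ∈-mapMaybe⁺ {x ∷ _} (there x∈) fx with f x
  ... | nothing = ∈-mapMaybe⁺ x∈ fx
  ... | just _  = there (∈-mapMaybe⁺ x∈ fx)

  mapMaybe-unique : (∀ {x x′ y} → f x ≡ just y → f x′ ≡ just y → x ≡ x′) →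
    ∀ {xs} → Unique xs → Unique (mapMaybe f xs)
  mapMaybe-unique f-inj {[]}     []             = []
  mapMaybe-unique f-inj {x ∷ xs} (x∉xs ∷ unique) with f x in fx
  ... | nothing = mapMaybe-unique f-inj unique
  ... | just y  = All.tabulate y∉ ∷ mapMaybe-unique f-inj unique
    where
    y∉ : ∀ {z} → z ∈ mapMaybe f xs → y ≢ z
    y∉ z∈ refl = let w , w∈ , fw = ∈-mapMaybe⁻ xs z∈ in All.lookup x∉xs w∈ (f-inj fx fw)

posPart-injective : ∀ {z z′ m} → posPart z ≡ just m → posPart z′ ≡ just m → z ≡ z′
posPart-injective {+ suc _} {+ suc _} refl refl = refl

nonposPart-injective : ∀ {z z′ m} → nonposPart z ≡ just m → nonposPart z′ ≡ just m → z ≡ z′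
nonposPart-injective {+ zero}  {+ zero}  refl refl = refl
nonposPart-injective { -[1+ _ ]} { -[1+ _ ]} refl refl = refl
nonposPart-injective {+ zero}  { -[1+ _ ]} refl ()
nonposPart-injective { -[1+ _ ]} {+ zero}  refl ()

posPart-just : ∀ {z m} → posPart z ≡ just m → 0 < m × z ≡ + m
posPart-just {+ suc _} refl = z<s , refl

nonposPart-just : ∀ {z m} → nonposPart z ≡ just m → z ≡ ℤ.- + m
nonposPart-just {+ zero}   refl = refl
nonposPart-just { -[1+ _ ]} refl = refl

nonposPart-neg : ∀ m → nonposPart (ℤ.- + m) ≡ just m
nonposPart-neg zero    = refl
nonposPart-neg (suc m) = refl

module _ {n : ℕ} (S : Family n) where

  ∉S⁺-diag : ∀ i {s} → ¬ s ∈S⁺[ S , i , i ]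
  ∉S⁺-diag i s∈ with FinP.<-cmp i i | s∈
  ... | tri< i<i _ _ | _ = FinP.<-irrefl refl i<i
  ... | tri≈ _ _ _   | ()
  ... | tri> _ _ i<i | _ = FinP.<-irrefl refl i<i

  S⁺-unique : ∀ i j → Unique (S⁺ S i j)
  S⁺-unique i j with FinP.<-cmp i j
  ... | tri< _ _ _ = mapMaybe-unique posPart posPart-injective (deduplicate-! ℤP._≟_ (S i j))
  ... | tri≈ _ _ _ = []
  ... | tri> _ _ _ = mapMaybe-unique nonposPart nonposPart-injective (deduplicate-! ℤP._≟_ (S j i))

  ∈S⁺⇒∈S-< : ∀ {i j s} → i Fin.< j → s ∈S⁺[ S , i , j ] → 0 < s × + s ∈ S i j
  ∈S⁺⇒∈S-< {i} {j} i<j s∈ with FinP.<-cmp i j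
  ... | tri≈ i≮j _ _ = ⊥-elim (i≮j i<j)
  ... | tri> i≮j _ _ = ⊥-elim (i≮j i<j)
  ... | tri< _ _ _ with ∈-mapMaybe⁻ posPart _ s∈
  ...   | z , z∈ , pz with posPart-just pz
  ...     | 0<s , refl = 0<s , ∈-deduplicate⁻ ℤP._≟_ (S i j) z∈

  ∈S⁺⇒∈S-> : ∀ {i j s} → j Fin.< i → s ∈S⁺[ S , i , j ] → ℤ.- + s ∈ S j i
  ∈S⁺⇒∈S-> {i} {j} j<i s∈ with FinP.<-cmp i j
  ... | tri< _ _ j≮i = ⊥-elim (j≮i j<i)
  ... | tri≈ _ _ j≮i = ⊥-elim (j≮i j<i)
  ... | tri> _ _ _ with ∈-mapMaybe⁻ nonposPart _ s∈
  ...   | z , z∈ , nz with nonposPart-just nz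
  ...     | refl = ∈-deduplicate⁻ ℤP._≟_ (S j i) z∈

  0∈S⁺⇒> : ∀ {i j} → 0 ∈S⁺[ S , i , j ] → j Fin.< i
  0∈S⁺⇒> {i} {j} 0∈ with FinP.<-cmp i j | 0∈
  ... | tri> _ _ j<i | _   = j<i
  ... | tri≈ _ _ _   | ()
  ... | tri< _ _ _   | 0∈′ =
    let _ , _ , p0 = ∈-mapMaybe⁻ posPart (deduplicate ℤP._≟_ (S i j)) 0∈′
    in ⊥-elim (ℕP.<-irrefl refl (proj₁ (posPart-just p0)))

  ∈S⇒∈S⁺-pos : ∀ {i j m} → i Fin.< j → + suc m ∈ S i j → suc m ∈S⁺[ S , i , j ]
  ∈S⇒∈S⁺-pos {i} {j} i<j m∈ with FinP.<-cmp i j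
  ... | tri< _ _ _   = ∈-mapMaybe⁺ posPart (∈-deduplicate⁺ ℤP._≟_ m∈) refl
  ... | tri≈ i≮j _ _ = ⊥-elim (i≮j i<j)
  ... | tri> i≮j _ _ = ⊥-elim (i≮j i<j)

  ∈S⇒∈S⁺-nonpos : ∀ {i j m} → i Fin.< j → ℤ.- + m ∈ S i j → m ∈S⁺[ S , j , i ]
  ∈S⇒∈S⁺-nonpos {i} {j} {m} i<j -m∈ with FinP.<-cmp j i
  ... | tri< _ _ i≮j = ⊥-elim (i≮j i<j)
  ... | tri≈ _ _ i≮j = ⊥-elim (i≮j i<j)
  ... | tri> _ _ _   = ∈-mapMaybe⁺ nonposPart (∈-deduplicate⁺ ℤP._≟_ -m∈) (nonposPart-neg m)

ℤ→ℚ-toℚᵘ : ∀ z → toℚᵘ (ℤ→ℚ z) ℚᵘ.≃ mkℚᵘ z 0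
ℤ→ℚ-toℚᵘ z = ℚP.toℚᵘ-fromℚᵘ (mkℚᵘ z 0)

ℤ→ℚ-+ : ∀ a b → ℤ→ℚ (a ℤ.+ b) ≡ ℤ→ℚ a ℚ.+ ℤ→ℚ b
ℤ→ℚ-+ a b = ℚP.toℚᵘ-injective (begin
  toℚᵘ (ℤ→ℚ (a ℤ.+ b))                  ≈⟨ ℤ→ℚ-toℚᵘ (a ℤ.+ b) ⟩
  mkℚᵘ (a ℤ.+ b) 0                       ≈⟨ *≡* (cong (ℤ._* + 1) (cong₂ ℤ._+_ (ℤP.*-identityʳ a) (ℤP.*-identityʳ b))) ⟨
  mkℚᵘ a 0 ℚᵘ.+ mkℚᵘ b 0                 ≈⟨ ℚᵘP.+-cong (ℤ→ℚ-toℚᵘ a) (ℤ→ℚ-toℚᵘ b) ⟨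
  toℚᵘ (ℤ→ℚ a) ℚᵘ.+ toℚᵘ (ℤ→ℚ b)        ≈⟨ ℚP.toℚᵘ-homo-+ (ℤ→ℚ a) (ℤ→ℚ b) ⟨
  toℚᵘ (ℤ→ℚ a ℚ.+ ℤ→ℚ b)                ∎)
  where open ℚᵘP.≃-Reasoning

ℤ→ℚ-* : ∀ a b → ℤ→ℚ (a ℤ.* b) ≡ ℤ→ℚ a ℚ.* ℤ→ℚ b
ℤ→ℚ-* a b = ℚP.toℚᵘ-injective (begin
  toℚᵘ (ℤ→ℚ (a ℤ.* b))                  ≈⟨ ℤ→ℚ-toℚᵘ (a ℤ.* b) ⟩
  mkℚᵘ a 0 ℚᵘ.* mkℚᵘ b 0                 ≈⟨ ℚᵘP.*-cong (ℤ→ℚ-toℚᵘ a) (ℤ→ℚ-toℚᵘ b) ⟨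
  toℚᵘ (ℤ→ℚ a) ℚᵘ.* toℚᵘ (ℤ→ℚ b)        ≈⟨ ℚP.toℚᵘ-homo-* (ℤ→ℚ a) (ℤ→ℚ b) ⟨
  toℚᵘ (ℤ→ℚ a ℚ.* ℤ→ℚ b)                ∎)
  where open ℚᵘP.≃-Reasoning

ℤ→ℚ-neg : ∀ a → ℤ→ℚ (ℤ.- a) ≡ ℚ.- ℤ→ℚ a
ℤ→ℚ-neg a = ℚP.toℚᵘ-injective (begin
  toℚᵘ (ℤ→ℚ (ℤ.- a))                    ≈⟨ ℤ→ℚ-toℚᵘ (ℤ.- a) ⟩
  ℚᵘ.- mkℚᵘ a 0                          ≈⟨ ℚᵘP.-‿cong (ℤ→ℚ-toℚᵘ a) ⟨
  ℚᵘ.- toℚᵘ (ℤ→ℚ a)                      ≈⟨ ℚP.toℚᵘ-homo‿- (ℤ→ℚ a) ⟨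
  toℚᵘ (ℚ.- ℤ→ℚ a)                       ∎)
  where open ℚᵘP.≃-Reasoning

ℤ→ℚ-injective : ∀ {a b} → ℤ→ℚ a ≡ ℤ→ℚ b → a ≡ b
ℤ→ℚ-injective {a} {b} eq with ℚᵘP.≃-trans (ℚᵘP.≃-sym (ℤ→ℚ-toℚᵘ a)) (ℚᵘP.≃-trans (ℚP.toℚᵘ-cong eq) (ℤ→ℚ-toℚᵘ b))
... | *≡* a*1≡b*1 = trans (sym (ℤP.*-identityʳ a)) (trans a*1≡b*1 (ℤP.*-identityʳ b))

ℤ→ℚ-mono-< : ∀ {a b} → a ℤ.< b → ℤ→ℚ a ℚ.< ℤ→ℚ b
ℤ→ℚ-mono-< {a} {b} a<b = ℚP.toℚᵘ-cancel-<
  (ℚᵘP.<-respʳ-≃ (ℚᵘP.≃-sym (ℤ→ℚ-toℚᵘ b)) (ℚᵘP.<-respˡ-≃ (ℚᵘP.≃-sym (ℤ→ℚ-toℚᵘ a))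
    (*<* (subst₂ ℤ._<_ (sym (ℤP.*-identityʳ a)) (sym (ℤP.*-identityʳ b)) a<b))))

ℤ→ℚ-cancel-< : ∀ {a b} → ℤ→ℚ a ℚ.< ℤ→ℚ b → a ℤ.< b
ℤ→ℚ-cancel-< {a} {b} lt
  with ℚᵘP.<-respʳ-≃ (ℤ→ℚ-toℚᵘ b) (ℚᵘP.<-respˡ-≃ (ℤ→ℚ-toℚᵘ a) (ℚP.toℚᵘ-mono-< lt))
... | *<* a*1<b*1 = subst₂ ℤ._<_ (ℤP.*-identityʳ a) (ℤP.*-identityʳ b) a*1<b*1

ℕ→ℚ-+ : ∀ m n → ℕ→ℚ (m + n) ≡ ℕ→ℚ m ℚ.+ ℕ→ℚ n
ℕ→ℚ-+ m n = trans (cong ℤ→ℚ (ℤP.pos-+ m n)) (ℤ→ℚ-+ (+ m) (+ n))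

ℕ→ℚ-* : ∀ m n → ℕ→ℚ (m * n) ≡ ℕ→ℚ m ℚ.* ℕ→ℚ n
ℕ→ℚ-* m n = trans (cong ℤ→ℚ (ℤP.pos-* m n)) (ℤ→ℚ-* (+ m) (+ n))

ℕ→ℚ-<⇔ : ∀ {m n} → ℕ→ℚ m ℚ.< ℕ→ℚ n ⇔ m < n
ℕ→ℚ-<⇔ = mk⇔ (ℤP.drop‿+<+ ∘ ℤ→ℚ-cancel-<) (ℤ→ℚ-mono-< ∘ +<+)

ℕ→ℚ-injective : ∀ {m n} → ℕ→ℚ m ≡ ℕ→ℚ n → m ≡ n
ℕ→ℚ-injective = ℤP.+-injective ∘ ℤ→ℚ-injective

/-*-cancel : ∀ m N .{{_ : NonZero N}} → ((+ m) / N) ℚ.* ℕ→ℚ N ≡ ℕ→ℚ m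
/-*-cancel m (suc d) = ℚP.toℚᵘ-injective (begin
  toℚᵘ ((+ m / suc d) ℚ.* ℕ→ℚ (suc d))         ≈⟨ ℚP.toℚᵘ-homo-* (+ m / suc d) (ℕ→ℚ (suc d)) ⟩
  toℚᵘ (+ m / suc d) ℚᵘ.* toℚᵘ (ℕ→ℚ (suc d))   ≈⟨ ℚᵘP.*-cong (ℚP.toℚᵘ-fromℚᵘ (mkℚᵘ (+ m) d)) (ℤ→ℚ-toℚᵘ (+ suc d)) ⟩
  mkℚᵘ (+ m) d ℚᵘ.* mkℚᵘ (+ suc d) 0
    ≈⟨ *≡* (trans (ℤP.*-identityʳ _) (cong (λ k → + m ℤ.* + k) (sym (ℕP.*-identityʳ (suc d))))) ⟩
  mkℚᵘ (+ m) 0                                  ≈⟨ ℤ→ℚ-toℚᵘ (+ m) ⟨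
  toℚᵘ (ℕ→ℚ m)                                  ∎)
  where open ℚᵘP.≃-Reasoning

module _ {N : ℕ} .{{_ : NonZero N}} {q : ℚ} (a b : ℕ) (scaled : ℕ→ℚ b ℚ.+ q ℚ.* ℕ→ℚ N ≡ ℕ→ℚ a) where

  private
    instance
      N-pos : ℚ.Positive (ℕ→ℚ N)
      N-pos = ℚP.normalize-pos N 1

    affine : ℚ → ℚ
    affine p = ℕ→ℚ b ℚ.+ p ℚ.* ℕ→ℚ N

    affine-ℕ→ℚ : ∀ s → affine (ℕ→ℚ s) ≡ ℕ→ℚ (b + s * N)
    affine-ℕ→ℚ s = sym (trans (ℕ→ℚ-+ b (s * N)) (cong (ℕ→ℚ b ℚ.+_) (ℕ→ℚ-* s N)))

    affine-<⇔ : ∀ {p p′} → p ℚ.< p′ ⇔ affine p ℚ.< affine p′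
    affine-<⇔ {p} {p′} = mk⇔
      (λ p<p′ → ℚP.+-monoʳ-< (ℕ→ℚ b) (ℚP.*-monoˡ-<-pos (ℕ→ℚ N) p<p′))
      (λ ap<ap′ → ℚP.≰⇒> (λ p′≤p → ℚP.<-irrefl refl (ℚP.≤-<-trans
        (ℚP.+-monoʳ-≤ (ℕ→ℚ b) (ℚP.*-monoʳ-≤-nonNeg (ℕ→ℚ N) {{ℚP.pos⇒nonNeg (ℕ→ℚ N)}} p′≤p)) ap<ap′)))

  ℕ→ℚ<scaled⇔ : ∀ s → ℕ→ℚ s ℚ.< q ⇔ b + s * N < a
  ℕ→ℚ<scaled⇔ s = mk⇔
    (λ s<q → to ℕ→ℚ-<⇔ (subst₂ ℚ._<_ (affine-ℕ→ℚ s) scaled (to affine-<⇔ s<q)))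
    (λ lt → from affine-<⇔ (subst₂ ℚ._<_ (sym (affine-ℕ→ℚ s)) (sym scaled) (from ℕ→ℚ-<⇔ lt)))

  scaled<ℕ→ℚ⇔ : ∀ s → q ℚ.< ℕ→ℚ s ⇔ a < b + s * N
  scaled<ℕ→ℚ⇔ s = mk⇔
    (λ q<s → to ℕ→ℚ-<⇔ (subst₂ ℚ._<_ scaled (affine-ℕ→ℚ s) (to affine-<⇔ q<s)))
    (λ lt → from affine-<⇔ (subst₂ ℚ._<_ (sym scaled) (sym (affine-ℕ→ℚ s)) (from ℕ→ℚ-<⇔ lt)))

  scaled≡ℕ→ℚ⇒ : ∀ s → q ≡ ℕ→ℚ s → b + s * N ≡ a
  scaled≡ℕ→ℚ⇒ s refl = ℕ→ℚ-injective (trans (sym (affine-ℕ→ℚ s)) scaled)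

basePoint-scaled : ∀ n (i j : Fin n) →
  ℕ→ℚ (toℕ i) ℚ.+ diff (basePoint n) i j ℚ.* ℕ→ℚ (suc n) ≡ ℕ→ℚ (toℕ j)
basePoint-scaled n i j = begin
  xᵢ ℚ.+ (ℚ.- (+ toℕ i / suc n) ℚ.- ℚ.- (+ toℕ j / suc n)) ℚ.* N
    ≡⟨ solve 4 (λ c x y w → c :+ (:- x :- :- y) :* w := c :+ y :* w :- x :* w) refl
         xᵢ (+ toℕ i / suc n) (+ toℕ j / suc n) N ⟩
  xᵢ ℚ.+ (+ toℕ j / suc n) ℚ.* N ℚ.- (+ toℕ i / suc n) ℚ.* N
    ≡⟨ cong₂ (λ y x → xᵢ ℚ.+ y ℚ.- x) (/-*-cancel (toℕ j) (suc n)) (/-*-cancel (toℕ i) (suc n)) ⟩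
  xᵢ ℚ.+ xⱼ ℚ.- xᵢ
    ≡⟨ solve 2 (λ c y → c :+ y :- c := y) refl xᵢ xⱼ ⟩
  xⱼ ∎
  where
  open ≡-Reasoning
  xᵢ xⱼ N : ℚ
  xᵢ = ℕ→ℚ (toℕ i)
  xⱼ = ℕ→ℚ (toℕ j)
  N = ℕ→ℚ (suc n)

basePoint-below : ∀ {n} (S : Family n) i j {s} → s ∈S⁺[ S , i , j ] → diff (basePoint n) i j ℚ.< ℕ→ℚ s
basePoint-below {n} S i j {s} s∈ =
  from (scaled<ℕ→ℚ⇔ (toℕ j) (toℕ i) (basePoint-scaled n i j) s) (by-order (FinP.<-cmp i j))
  where
  by-order : Tri (i Fin.< j) (i ≡ j) (j Fin.< i) → toℕ j < toℕ i + s * suc n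
  by-order (tri< i<j _ _) = ℕP.<-≤-trans (ℕP.m<n⇒m<1+n (FinP.toℕ<n j))
    (ℕP.≤-trans (ℕP.m≤n*m (suc n) s {{ℕ.>-nonZero (proj₁ (∈S⁺⇒∈S-< S i<j s∈))}}) (ℕP.m≤n+m _ (toℕ i)))
  by-order (tri≈ _ refl _) = ⊥-elim (∉S⁺-diag S i s∈)
  by-order (tri> _ _ j<i)  = ℕP.<-≤-trans j<i (ℕP.m≤m+n (toℕ i) _)

latticePoint : ∀ {n} N .{{_ : NonZero N}} → (Fin n → ℕ) → Point n
latticePoint N X i = (+ X i) / N

latticePoint-scaled : ∀ {n} N .{{_ : NonZero N}} (X : Fin n → ℕ) a b →
  ℕ→ℚ (X b) ℚ.+ diff (latticePoint N X) a b ℚ.* ℕ→ℚ N ≡ ℕ→ℚ (X a)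
latticePoint-scaled N X a b = begin
  ℕ→ℚ (X b) ℚ.+ (+ X a / N ℚ.- + X b / N) ℚ.* ℕ→ℚ N
    ≡⟨ solve 4 (λ c x y w → c :+ (x :- y) :* w := c :+ x :* w :- y :* w) refl
         (ℕ→ℚ (X b)) (+ X a / N) (+ X b / N) (ℕ→ℚ N) ⟩
  ℕ→ℚ (X b) ℚ.+ (+ X a / N) ℚ.* ℕ→ℚ N ℚ.- (+ X b / N) ℚ.* ℕ→ℚ N
    ≡⟨ cong₂ (λ x y → ℕ→ℚ (X b) ℚ.+ x ℚ.- y) (/-*-cancel (X a) N) (/-*-cancel (X b) N) ⟩
  ℕ→ℚ (X b) ℚ.+ ℕ→ℚ (X a) ℚ.- ℕ→ℚ (X b)
    ≡⟨ solve 2 (λ c x → c :+ x :- c := x) refl (ℕ→ℚ (X b)) (ℕ→ℚ (X a)) ⟩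
  ℕ→ℚ (X a) ∎
  where open ≡-Reasoning

-- Crossed hyperplanes and the label

≮∧≢⇒> : ∀ {p q : ℚ} → ¬ p ℚ.< q → p ≢ q → q ℚ.< p
≮∧≢⇒> {p} {q} p≮q p≢q with ℚP.<-cmp p q
... | tri< p<q _ _ = ⊥-elim (p≮q p<q)
... | tri≈ _ p≡q _ = ⊥-elim (p≢q p≡q)
... | tri> _ _ q<p = q<p

neg-involutive : ∀ (p : ℚ) → ℚ.- (ℚ.- p) ≡ p
neg-involutive = solve 1 (λ p → :- (:- p) := p) refl

neg-<⇔ : ∀ {p q : ℚ} → p ℚ.< q ⇔ ℚ.- q ℚ.< ℚ.- p
neg-<⇔ {p} {q} = mk⇔ ℚP.neg-antimono-<
  (λ -q<-p → subst₂ ℚ._<_ (neg-involutive p) (neg-involutive q) (ℚP.neg-antimono-< -q<-p))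

diff-antisym : ∀ {n} (x : Point n) i j → diff x j i ≡ ℚ.- diff x i j
diff-antisym x i j = solve 2 (λ a b → b :- a := :- (a :- b)) refl (x i) (x j)

crosses⇔crosses-flipped : ∀ {n} (x : Point n) i j s →
  ℕ→ℚ s ℚ.< diff x i j ⇔ diff x j i ℚ.< ℤ→ℚ (ℤ.- + s)
crosses⇔crosses-flipped x i j s = mk⇔
  (λ lt → subst₂ ℚ._<_ (sym (diff-antisym x i j)) (sym (ℤ→ℚ-neg (+ s))) (to neg-<⇔ lt))
  (λ lt → from neg-<⇔ (subst₂ ℚ._<_ (diff-antisym x i j) (ℤ→ℚ-neg (+ s)) lt))

does≡true⇔ : ∀ {a} {A : Set a} (a? : Dec A) → does a? ≡ true ⇔ A
does≡true⇔ (yes a) = mk⇔ (λ _ → a) (λ _ → refl)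
does≡true⇔ (no ¬a) = mk⇔ (λ ()) (⊥-elim ∘ ¬a)

separates⇔ : ∀ {n} (x y : Point n) i j c → diff y i j ℚ.< c →
  separates x y i j c ≡ true ⇔ c ℚ.< diff x i j
separates⇔ x y i j c y<c
  rewrite dec-false (c ℚP.<? diff y i j) (ℚP.<-asym y<c) | dec-true (diff y i j ℚP.<? c) y<c
        | ∧-zeroʳ (does (diff x i j ℚP.<? c)) | ∧-identityʳ (does (c ℚP.<? diff x i j))
  = does≡true⇔ (c ℚP.<? diff x i j)

count-threshold : ∀ (xs : List ℕ) {d d′ : ℚ} →
  count (λ s → ℕ→ℚ s ℚP.<? d) xs ≡ count (λ s → ℕ→ℚ s ℚP.<? d′) xs →
  ∀ {s} → s ∈ xs → ℕ→ℚ s ℚ.< d → ℕ→ℚ s ℚ.< d′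
count-threshold xs {d} {d′} same {s} s∈ s<d with ℕ→ℚ s ℚP.<? d′
... | yes s<d′ = s<d′
... | no s≮d′ = ⊥-elim (ℕP.<-irrefl (sym same)
      (count-mono-< (λ t → ℕ→ℚ t ℚP.<? d′) (λ t → ℕ→ℚ t ℚP.<? d)
        (λ _ t<d′ → ℚP.<-≤-trans t<d′ (ℚP.≤-trans (ℚP.≮⇒≥ s≮d′) (ℚP.<⇒≤ s<d))) s∈ s≮d′ s<d))

module _ {n : ℕ} (S : Family n) where

  crossings : Point n → Fin n → Fin n → ℕ
  crossings x i j = count (λ s → ℕ→ℚ s ℚP.<? diff x i j) (S⁺ S i j)

  -- The base point lies below every H_{i,j,s} with s ∈ S⁺_{i,j}, so such a hyperplane separates
  -- x from R₀ exactly when s < x_i − x_j.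
  label≡∑crossings : ∀ x i → label S x i ≡ ∑ (crossings x i)
  label≡∑crossings x i = trans (∑-allFin separated) (∑-cong λ j →
    count-cong (separates? j) (λ s → ℕ→ℚ s ℚP.<? diff x i j) {S⁺ S i j}
      (λ s∈ → to (separates⇔ x (basePoint n) i j _ (basePoint-below S i j s∈)))
      (λ s∈ → from (separates⇔ x (basePoint n) i j _ (basePoint-below S i j s∈))))
    where
    separates? : ∀ j → Decidable (λ s → separates x (basePoint n) i j (ℕ→ℚ s) ≡ true)
    separates? j s = separates x (basePoint n) i j (ℕ→ℚ s) Bool.≟ true
    separated : Fin n → ℕ
    separated j = count (separates? j) (S⁺ S i j)

  Crossings⊆ : Point n → Point n → Set
  Crossings⊆ x y = ∀ a b {s} → s ∈S⁺[ S , a , b ] → ℕ→ℚ s ℚ.< diff x a b → ℕ→ℚ s ℚ.< diff y a b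

  SameRegion⇒Crossings⊆ : ∀ x y → Generic S y → SameRegion S x y → Crossings⊆ x y
  SameRegion⇒Crossings⊆ x y gen-y same a b {s} s∈ s<x = by-cases (FinP.<-cmp a b)
    where
    by-cases : Tri (a Fin.< b) (a ≡ b) (b Fin.< a) → ℕ→ℚ s ℚ.< diff y a b
    by-cases (tri< a<b _ _) = let _ , +s∈ = ∈S⁺⇒∈S-< S a<b s∈ in
      ≮∧≢⇒> (λ y<s → ℚP.<-asym s<x (from (same a b a<b (+ s) +s∈) y<s)) (gen-y a b a<b (+ s) +s∈)
    by-cases (tri≈ _ refl _) = ⊥-elim (∉S⁺-diag S a s∈)
    by-cases (tri> _ _ b<a) =
      from (crosses⇔crosses-flipped y a b s)
        (to (same b a b<a _ (∈S⁺⇒∈S-> S b<a s∈)) (to (crosses⇔crosses-flipped x a b s) s<x))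

  Crossings⊆⇒SameRegion : ∀ x y → Generic S x → Generic S y → Crossings⊆ x y → Crossings⊆ y x →
    SameRegion S x y
  Crossings⊆⇒SameRegion x y gen-x gen-y x⊆y y⊆x i j i<j z z∈ = by-sign z z∈
    where
    below : ∀ u v {m} → Generic S v → Crossings⊆ v u → + suc m ∈ S i j →
      diff u i j ℚ.< ℕ→ℚ (suc m) → diff v i j ℚ.< ℕ→ℚ (suc m)
    below u v gen-v v⊆u m∈ u<m = ≮∧≢⇒>
      (λ m<v → ℚP.<-asym u<m (v⊆u i j (∈S⇒∈S⁺-pos S i<j m∈) m<v)) (gen-v i j i<j _ m∈ ∘ sym)
    flipped : ∀ u v s → ℤ.- + s ∈ S i j → Crossings⊆ u v →
      diff u i j ℚ.< ℤ→ℚ (ℤ.- + s) → diff v i j ℚ.< ℤ→ℚ (ℤ.- + s)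
    flipped u v s s∈ u⊆v u<-s = to (crosses⇔crosses-flipped v j i s)
      (u⊆v j i (∈S⇒∈S⁺-nonpos S i<j s∈) (from (crosses⇔crosses-flipped u j i s) u<-s))
    by-sign : ∀ z → z ∈ S i j → (diff x i j ℚ.< ℤ→ℚ z) ⇔ (diff y i j ℚ.< ℤ→ℚ z)
    by-sign (+ suc m)  z∈ = mk⇔ (below x y gen-y y⊆x z∈) (below y x gen-x x⊆y z∈)
    by-sign (+ zero)   z∈ = mk⇔ (flipped x y 0 z∈ x⊆y) (flipped y x 0 z∈ y⊆x)
    by-sign -[1+ m ]   z∈ = mk⇔ (flipped x y (suc m) z∈ x⊆y) (flipped y x (suc m) z∈ y⊆x)

  module _ (x y : Point n) where

    crossings-cong : Crossings⊆ x y → Crossings⊆ y x → ∀ i j → crossings x i j ≡ crossings y i j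
    crossings-cong x⊆y y⊆x i j =
      count-cong (λ s → ℕ→ℚ s ℚP.<? diff x i j) (λ s → ℕ→ℚ s ℚP.<? diff y i j) {S⁺ S i j} (x⊆y i j) (y⊆x i j)

    crossings≡⇒crossed : ∀ a b → crossings x a b ≡ crossings y a b →
      ∀ {s} → s ∈S⁺[ S , a , b ] → ℕ→ℚ s ℚ.< diff x a b → ℕ→ℚ s ℚ.< diff y a b
    crossings≡⇒crossed a b same = count-threshold (S⁺ S a b) same

    crossings-mono : ∀ a b → diff x a b ℚ.≤ diff y a b → crossings x a b ≤ crossings y a b
    crossings-mono a b x≤y = count-mono (λ s → ℕ→ℚ s ℚP.<? diff x a b) (λ s → ℕ→ℚ s ℚP.<? diff y a b) {S⁺ S a b}
      (λ _ s<x → ℚP.<-≤-trans s<x x≤y)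

    crossings<⇒∃ : ∀ a b → crossings x a b < crossings y a b →
      ∃[ s ] (s ∈S⁺[ S , a , b ] × diff x a b ℚ.≤ ℕ→ℚ s × ℕ→ℚ s ℚ.< diff y a b)
    crossings<⇒∃ a b lt =
      let s , s∈ , s≮x , s<y = count<count⇒∃ (λ s → ℕ→ℚ s ℚP.<? diff x a b) (λ s → ℕ→ℚ s ℚP.<? diff y a b) {S⁺ S a b} lt
      in s , s∈ , ℚP.≮⇒≥ s≮x , s<y

  label-cong : ∀ x y → Generic S x → Generic S y → SameRegion S x y → ∀ i → label S x i ≡ label S y i
  label-cong x y gen-x gen-y same i = begin
    label S x i             ≡⟨ label≡∑crossings x i ⟩
    ∑ (crossings x i)       ≡⟨ ∑-cong (crossings-cong x y x⊆y y⊆x i) ⟩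
    ∑ (crossings y i)       ≡⟨ label≡∑crossings y i ⟨
    label S y i             ∎
    where
    open ≡-Reasoning
    x⊆y : Crossings⊆ x y
    x⊆y = SameRegion⇒Crossings⊆ x y gen-y same
    y⊆x : Crossings⊆ y x
    y⊆x = SameRegion⇒Crossings⊆ y x gen-x (λ i j i<j z z∈ → ⇔-sym (same i j i<j z z∈))

-- Labels are parking functions

vertex-inject₁ : ∀ {n} (i : Fin n) → vertex (inject₁ i) ≡ just i
vertex-inject₁ {suc n} zero    = refl
vertex-inject₁ {suc n} (suc i) = cong (Maybe.map suc) (vertex-inject₁ i)

vertex-fromℕ : ∀ n → vertex (fromℕ n) ≡ nothing
vertex-fromℕ zero    = refl
vertex-fromℕ (suc n) = cong (Maybe.map suc) (vertex-fromℕ n)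

module _ {n : ℕ} (S : Family n) where

  arcsTo : (Fin n → Bool) → Fin n → ℕ
  arcsTo W u = ∑ (W ↾ (length ∘ S⁺ S u))

  outArcs≡ : ∀ (U : Subset n) u → outArcs (arcsD S) U u ≡ arcsTo (not ∘ lookup U) u + 1
  outArcs≡ U u = trans (∑-allFin arcsFrom) (trans (∑-init-last arcsFrom) (cong₂ _+_ (∑-cong inner) last))
    where
    arcsFrom : Fin (suc n) → ℕ
    arcsFrom v = if inU U v then 0 else arcsD S (inject₁ u) v
    inner : ∀ v → arcsFrom (inject₁ v) ≡ ((not ∘ lookup U) ↾ (length ∘ S⁺ S u)) v
    inner v rewrite vertex-inject₁ u | vertex-inject₁ v with lookup U v
    ... | true  = refl
    ... | false = refl
    last : arcsFrom (fromℕ n) ≡ 1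
    last rewrite vertex-inject₁ u | vertex-fromℕ n = refl

  crossings-≡0 : ∀ x a b → x a ℚ.≤ x b → crossings S x a b ≡ 0
  crossings-≡0 x a b xa≤xb = count-none (λ s → ℕ→ℚ s ℚP.<? diff x a b) {S⁺ S a b}
    (λ {s} _ s<d → ℚP.<-irrefl refl (ℚP.<-≤-trans (ℚP.≤-<-trans (0≤ℕ→ℚ s) s<d) d≤0))
    where
    0≤ℕ→ℚ : ∀ s → 0ℚ ℚ.≤ ℕ→ℚ s
    0≤ℕ→ℚ s = ℚP.nonNegative⁻¹ _ {{ℚP.normalize-nonNeg s 1}}
    d≤0 : diff x a b ℚ.≤ 0ℚ
    d≤0 = subst (diff x a b ℚ.≤_) (ℚP.+-inverseʳ (x b)) (ℚP.+-monoˡ-≤ (ℚ.- x b) xa≤xb)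

  label-park : ∀ x → Park S (label S x)
  label-park x U (w , w∈U) =
    at-minimum (argmin ℚ._≤_ ℚP.≤-total ℚP.≤-trans (λ v → lookup U v Bool.≟ true) x (w , VecP.[]=⇒lookup w∈U))
    where
    at-minimum : ∃[ u ] (lookup U u ≡ true × ∀ {j} → lookup U j ≡ true → x u ℚ.≤ x j) →
      ∃[ u ] (u Subset.∈ U × label S x u < outArcs (arcsD S) U u)
    at-minimum (u , u∈U , u-min) = u , VecP.lookup⇒[]= u U u∈U , (begin-strict
      label S x u                    ≡⟨ label≡∑crossings S x u ⟩
      ∑ (crossings S x u)            ≤⟨ ∑-mono-≤ bound ⟩
      arcsTo (not ∘ lookup U) u      <⟨ ℕP.m<m+n _ z<s ⟩
      arcsTo (not ∘ lookup U) u + 1  ≡⟨ outArcs≡ U u ⟨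
      outArcs (arcsD S) U u          ∎)
      where
      open ℕP.≤-Reasoning
      bound : ∀ j → crossings S x u j ≤ ((not ∘ lookup U) ↾ (length ∘ S⁺ S u)) j
      bound j with lookup U j in Uj
      ... | true  = ℕP.≤-reflexive (crossings-≡0 x u j (u-min Uj))
      ... | false = ListP.length-filter _ (S⁺ S u j)

  park-unplaced : ∀ {p} → Park S p → ∀ (W : Fin n → Bool) → ∃[ u ] W u ≡ false →
    ∃[ u ] (W u ≡ false × p u ≤ arcsTo W u)
  park-unplaced {p} park W (u₀ , Wu₀) =
    let u , u∈U , p<out = park U (u₀ , VecP.lookup⇒[]= u₀ U (trans (U≡∁W u₀) (cong not Wu₀)))
    in u , ∈U⇒unplaced u∈U , ℕP.≤-pred (subst (p u <_) (outArcs≡suc u) p<out)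
    where
    U : Subset n
    U = Vec.tabulate (not ∘ W)
    U≡∁W : ∀ j → lookup U j ≡ not (W j)
    U≡∁W = VecP.lookup∘tabulate (not ∘ W)
    ∈U⇒unplaced : ∀ {u} → u Subset.∈ U → W u ≡ false
    ∈U⇒unplaced {u} u∈U = trans (sym (not-involutive (W u))) (cong not (trans (sym (U≡∁W u)) (VecP.[]=⇒lookup u∈U)))
    outArcs≡suc : ∀ u → outArcs (arcsD S) U u ≡ suc (arcsTo W u)
    outArcs≡suc u = trans (outArcs≡ U u) (trans (ℕP.+-comm _ 1) (cong suc (∑-cong λ j →
      cong (λ b → if b then length (S⁺ S u j) else 0) (trans (cong not (U≡∁W j)) (not-involutive (W j))))))

-- Injectivity

module _ {n : ℕ} (S : Family n) (propX : PropertyX S) (propY : PropertyY S) where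

  private
    triangle-half : ∀ {v i w s s′} → v ≢ i → v ≢ w → i ≢ w →
      s ∈S⁺[ S , v , i ] → s′ ∈S⁺[ S , v , w ] → s < s′ ⊎ (s ≡ s′ × w Fin.< i) →
      (s′ ∸ s) ∈S⁺[ S , i , w ]
    triangle-half {v} {i} {w} {zero} {s′} v≢i v≢w i≢w s∈ s′∈ s<s′
      with propX i v w (0∈S⁺⇒> S s∈) (i≢w ∘ sym) (v≢w ∘ sym) s′ s′∈ | s<s′
    ... | inj₁ s′∈iw        | _                 = s′∈iw
    ... | inj₂ (refl , _)   | inj₁ 0<0          = ⊥-elim (ℕP.<-irrefl refl 0<0)
    ... | inj₂ (_ , i<w)    | inj₂ (_ , w<i)    = ⊥-elim (FinP.<-asym i<w w<i)
    triangle-half {v} {i} {w} {suc k} {s′} v≢i v≢w i≢w s∈ s′∈ s<s′ with (s′ ∸ suc k) ∈? S⁺ S i w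
    ... | yes t∈ = t∈
    ... | no t∉  = ⊥-elim (propY i w v i≢w (v≢i ∘ sym) (v≢w ∘ sym) (s′ ∸ suc k) gap t∉ (suc k) z<s
                    (subst (_∈S⁺[ S , v , w ]) (sym (ℕP.m∸n+n≡m s≤s′)) s′∈))
      where
      s≤s′ : suc k ≤ s′
      s≤s′ = [ ℕP.<⇒≤ , ℕP.≤-reflexive ∘ proj₁ ] s<s′
      gap : 0 < s′ ∸ suc k ⊎ w Fin.< i
      gap = Sum.map ℕP.m<n⇒0<n∸m proj₂ s<s′

  S⁺-triangle : ∀ {v i w s s′} → v ≢ i → v ≢ w → i ≢ w →
    s ∈S⁺[ S , v , i ] → s′ ∈S⁺[ S , v , w ] →
    (s ≤ s′ × (s′ ∸ s) ∈S⁺[ S , i , w ]) ⊎ (s′ ≤ s × (s ∸ s′) ∈S⁺[ S , w , i ])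
  S⁺-triangle {v} {i} {w} {s} {s′} v≢i v≢w i≢w s∈ s′∈ with ℕP.<-cmp s s′
  ... | tri< s<s′ _ _ = inj₁ (ℕP.<⇒≤ s<s′ , triangle-half v≢i v≢w i≢w s∈ s′∈ (inj₁ s<s′))
  ... | tri> _ _ s′<s = inj₂ (ℕP.<⇒≤ s′<s , triangle-half v≢w v≢i (i≢w ∘ sym) s′∈ s∈ (inj₁ s′<s))
  ... | tri≈ _ refl _ = by-order (FinP.<-cmp i w)
    where
    by-order : Tri (i Fin.< w) (i ≡ w) (w Fin.< i) →
      (s ≤ s × (s ∸ s) ∈S⁺[ S , i , w ]) ⊎ (s ≤ s × (s ∸ s) ∈S⁺[ S , w , i ])
    by-order (tri< i<w _ _) = inj₂ (ℕP.≤-refl , triangle-half v≢w v≢i (i≢w ∘ sym) s′∈ s∈ (inj₂ (refl , i<w)))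
    by-order (tri≈ _ i≡w _) = ⊥-elim (i≢w i≡w)
    by-order (tri> _ _ w<i) = inj₁ (ℕP.≤-refl , triangle-half v≢i v≢w i≢w s∈ s′∈ (inj₂ (refl , w<i)))

ℕ→ℚ-∸ : ∀ {s s′} → s ≤ s′ → ℕ→ℚ (s′ ∸ s) ≡ ℕ→ℚ s′ ℚ.- ℕ→ℚ s
ℕ→ℚ-∸ {s} {s′} s≤s′ = begin
  ℕ→ℚ (s′ ∸ s)                           ≡⟨ solve 2 (λ a b → a := (a :+ b) :- b) refl (ℕ→ℚ (s′ ∸ s)) (ℕ→ℚ s) ⟩
  (ℕ→ℚ (s′ ∸ s) ℚ.+ ℕ→ℚ s) ℚ.- ℕ→ℚ s    ≡⟨ cong (ℚ._- ℕ→ℚ s) (sym (ℕ→ℚ-+ (s′ ∸ s) s)) ⟩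
  ℕ→ℚ (s′ ∸ s + s) ℚ.- ℕ→ℚ s           ≡⟨ cong (λ m → ℕ→ℚ m ℚ.- ℕ→ℚ s) (ℕP.m∸n+n≡m s≤s′) ⟩
  ℕ→ℚ s′ ℚ.- ℕ→ℚ s                       ∎
  where open ≡-Reasoning

module _ {n : ℕ} (p : Point n) (v i w : Fin n) {s s′ : ℕ} (s≤s′ : s ≤ s′) where

  private
    diff-via : diff p i w ≡ diff p v w ℚ.- diff p v i
    diff-via = solve 3 (λ a b c → b :- c := (a :- c) :- (a :- b)) refl (p v) (p i) (p w)

  crosses-∸ : diff p v i ℚ.≤ ℕ→ℚ s → ℕ→ℚ s′ ℚ.< diff p v w → ℕ→ℚ (s′ ∸ s) ℚ.< diff p i w
  crosses-∸ vi≤s s′<vw = subst₂ ℚ._<_ (sym (ℕ→ℚ-∸ s≤s′)) (sym diff-via)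
    (ℚP.+-mono-<-≤ s′<vw (ℚP.neg-antimono-≤ vi≤s))

  misses-∸ : ℕ→ℚ s ℚ.< diff p v i → diff p v w ℚ.≤ ℕ→ℚ s′ → diff p i w ℚ.< ℕ→ℚ (s′ ∸ s)
  misses-∸ s<vi vw≤s′ = subst₂ ℚ._<_ (sym diff-via) (sym (ℕ→ℚ-∸ s≤s′))
    (ℚP.+-mono-≤-< vw≤s′ (ℚP.neg-antimono-< s<vi))

module _ {n : ℕ} (S : Family n) (propX : PropertyX S) (propY : PropertyY S) (x z : Point n) where

  private
    δ : Fin n → ℚ
    δ k = x k ℚ.- z k

    diff-shift : ∀ a b → diff x a b ≡ diff z a b ℚ.+ (δ a ℚ.- δ b)
    diff-shift a b = solve 4 (λ xa xb za zb → xa :- xb := (za :- zb) :+ ((xa :- za) :- (xb :- zb))) refl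
      (x a) (x b) (z a) (z b)

    δ≤⇒diff≤ : ∀ a b → δ b ℚ.≤ δ a → diff z a b ℚ.≤ diff x a b
    δ≤⇒diff≤ a b δb≤δa = subst₂ ℚ._≤_ (ℚP.+-identityʳ (diff z a b)) (sym (diff-shift a b))
      (ℚP.+-monoʳ-≤ (diff z a b) (subst (ℚ._≤ δ a ℚ.- δ b) (ℚP.+-inverseʳ (δ b)) (ℚP.+-monoˡ-≤ (ℚ.- δ b) δb≤δa)))

    δ≤⇒diff≥ : ∀ a b → δ a ℚ.≤ δ b → diff x a b ℚ.≤ diff z a b
    δ≤⇒diff≥ a b δa≤δb = subst₂ ℚ._≤_ (sym (diff-shift a b)) (ℚP.+-identityʳ (diff z a b))
      (ℚP.+-monoʳ-≤ (diff z a b) (subst (δ a ℚ.- δ b ℚ.≤_) (ℚP.+-inverseʳ (δ b)) (ℚP.+-monoˡ-≤ (ℚ.- δ b) δa≤δb)))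

    diff<⇒δ< : ∀ a b → diff z a b ℚ.< diff x a b → δ b ℚ.< δ a
    diff<⇒δ< a b z<x = ℚP.≰⇒> (λ δa≤δb → ℚP.<-irrefl refl (ℚP.<-≤-trans z<x (δ≤⇒diff≥ a b δa≤δb)))

    rank : Fin n → ℕ
    rank v = count (λ u → δ u ℚP.<? δ v) (allFin n)

    rank-mono-< : ∀ {w v} → δ w ℚ.< δ v → rank w < rank v
    rank-mono-< {w} {v} δw<δv = count-mono-< (λ u → δ u ℚP.<? δ w) (λ u → δ u ℚP.<? δ v)
      (λ _ δu<δw → ℚP.<-trans δu<δw δw<δv) (∈-allFin w) (ℚP.<-irrefl refl) δw<δv

    -- The triangle rule yields a hyperplane between i and w crossed by exactly one of x and z.
    no-mixed-crossings : ∀ v i w {s s′} → s ∈S⁺[ S , v , i ] → s′ ∈S⁺[ S , v , w ] →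
      diff x v i ℚ.≤ ℕ→ℚ s → ℕ→ℚ s ℚ.< diff z v i → diff z v w ℚ.≤ ℕ→ℚ s′ → ℕ→ℚ s′ ℚ.< diff x v w →
      crossings S x i w ≡ crossings S z i w → crossings S x w i ≡ crossings S z w i → ⊥
    no-mixed-crossings v i w {s} {s′} s∈ s′∈ xvi≤s s<zvi zvw≤s′ s′<xvw row col =
      by-triangle (S⁺-triangle S propX propY v≢i v≢w i≢w s∈ s′∈)
      where
      v≢i : v ≢ i
      v≢i refl = ∉S⁺-diag S v s∈
      v≢w : v ≢ w
      v≢w refl = ∉S⁺-diag S v s′∈
      i≢w : i ≢ w
      i≢w refl = ℚP.<-irrefl refl
        (ℚP.≤-<-trans xvi≤s (ℚP.<-≤-trans s<zvi (ℚP.≤-trans zvw≤s′ (ℚP.<⇒≤ s′<xvw))))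
      by-triangle : (s ≤ s′ × (s′ ∸ s) ∈S⁺[ S , i , w ]) ⊎ (s′ ≤ s × (s ∸ s′) ∈S⁺[ S , w , i ]) → ⊥
      by-triangle (inj₁ (s≤s′ , t∈)) = ℚP.<-asym (misses-∸ z v i w s≤s′ s<zvi zvw≤s′)
        (crossings≡⇒crossed S x z i w row t∈ (crosses-∸ x v i w s≤s′ xvi≤s s′<xvw))
      by-triangle (inj₂ (s′≤s , t∈)) = ℚP.<-asym (misses-∸ x v w i s′≤s s′<xvw xvi≤s)
        (crossings≡⇒crossed S z x w i (sym col) t∈ (crosses-∸ z v w i s′≤s zvw≤s′ s<zvi))

  RowSumsAgree : (Fin n → Bool) → Set
  RowSumsAgree U = ∀ v → U v ≡ true → ∑ (U ↾ crossings S x v) ≡ ∑ (U ↾ crossings S z v)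

  module _ (U : Fin n → Bool) (rows : RowSumsAgree U)
           (i : Fin n) (i∈U : U i ≡ true) (i-max : ∀ {j} → U j ≡ true → δ j ℚ.≤ δ i) where

    row-agrees : ∀ j → U j ≡ true → crossings S x i j ≡ crossings S z i j
    row-agrees j j∈U = begin
      crossings S x i j          ≡⟨ ↾-true U (crossings S x i) j∈U ⟨
      (U ↾ crossings S x i) j    ≡⟨ ∑≡∑⇒≡ z≤x (sym (rows i i∈U)) j ⟨
      (U ↾ crossings S z i) j    ≡⟨ ↾-true U (crossings S z i) j∈U ⟩
      crossings S z i j          ∎
      where
      open ≡-Reasoning
      z≤x : ∀ k → (U ↾ crossings S z i) k ≤ (U ↾ crossings S x i) k
      z≤x = ↾-mono-≤ U (λ k k∈U → crossings-mono S z x i k (δ≤⇒diff≤ i k (i-max k∈U)))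

    -- Induction along increasing x − z: a deficit in column i at v forces a surplus in row v at
    -- some w with smaller x − z.
    column-agrees : ∀ v → U v ≡ true → crossings S x v i ≡ crossings S z v i
    column-agrees v = go v (<-wellFounded (rank v))
      where
      no-deficit : ∀ v → U v ≡ true →
        (∀ w → U w ≡ true → rank w < rank v → crossings S x w i ≡ crossings S z w i) →
        ¬ crossings S x v i < crossings S z v i
      no-deficit v v∈U ih deficit =
        let s , s∈ , xvi≤s , s<zvi = crossings<⇒∃ S x z v i deficit
            w , surplus = ∑≡∑⇒∃> (rows v v∈U) i
              (subst₂ _<_ (sym (↾-true U (crossings S x v) i∈U)) (sym (↾-true U (crossings S z v) i∈U)) deficit)
            w∈U , surplus′ = ↾-<⇒∈ U (crossings S z v) (crossings S x v) surplus
            s′ , s′∈ , zvw≤s′ , s′<xvw = crossings<⇒∃ S z x v w surplus′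
        in no-mixed-crossings v i w s∈ s′∈ xvi≤s s<zvi zvw≤s′ s′<xvw (row-agrees w w∈U)
             (ih w w∈U (rank-mono-< (diff<⇒δ< v w (ℚP.≤-<-trans zvw≤s′ s′<xvw))))
      go : ∀ v → Acc _<_ (rank v) → U v ≡ true → crossings S x v i ≡ crossings S z v i
      go v (acc smaller) v∈U = ℕP.≤-antisym (crossings-mono S x z v i (δ≤⇒diff≥ v i (i-max v∈U)))
        (ℕP.≮⇒≥ (no-deficit v v∈U (λ w w∈U rank< → go w (smaller rank<) w∈U)))

    rows-without-max : RowSumsAgree (U ─ i)
    rows-without-max v v∈U′ = ℕP.+-cancelʳ-≡ (crossings S x v i) _ _ (begin
      ∑ ((U ─ i) ↾ crossings S x v) + crossings S x v i ≡⟨ split (crossings S x v) ⟨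
      ∑ (U ↾ crossings S x v)                           ≡⟨ rows v v∈U ⟩
      ∑ (U ↾ crossings S z v)                           ≡⟨ split (crossings S z v) ⟩
      ∑ ((U ─ i) ↾ crossings S z v) + crossings S z v i ≡⟨ cong (_+_ _) (column-agrees v v∈U) ⟨
      ∑ ((U ─ i) ↾ crossings S z v) + crossings S x v i ∎)
      where
      open ≡-Reasoning
      v∈U : U v ≡ true
      v∈U = ─-⊆ U v∈U′
      split : ∀ f → ∑ (U ↾ f) ≡ ∑ ((U ─ i) ↾ f) + f i
      split f = ∑↾-split U (U ─ i) i f i∈U (updateAt-updates i U) (λ j j≢i → sym (updateAt-minimal j i U j≢i))

  crossings-agree : ∀ k (U : Fin n → Bool) → size U ≤ k → RowSumsAgree U →
    ∀ v j → U v ≡ true → U j ≡ true → crossings S x v j ≡ crossings S z v j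
  crossings-agree zero    U size≤0 rows v j v∈U _ = ⊥-elim (ℕP.n≮0 (subst (_≤ 0) (size-─ U v∈U) size≤0))
  crossings-agree (suc k) U size≤ rows v j v∈U j∈U =
    around (argmin (λ a b → b ℚ.≤ a) (λ a b → ℚP.≤-total b a) (λ a≥b b≥c → ℚP.≤-trans b≥c a≥b)
                   (λ u → U u Bool.≟ true) δ (v , v∈U))
    where
    around : ∃[ i ] (U i ≡ true × ∀ {j} → U j ≡ true → δ j ℚ.≤ δ i) → crossings S x v j ≡ crossings S z v j
    around (i , i∈U , i-max) = by-position (v FinP.≟ i) (j FinP.≟ i)
      where
      by-position : Dec (v ≡ i) → Dec (j ≡ i) → crossings S x v j ≡ crossings S z v j
      by-position (yes v≡i) _         = subst (λ v → crossings S x v j ≡ crossings S z v j) (sym v≡i)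
                                           (row-agrees U rows i i∈U i-max j j∈U)
      by-position (no _)    (yes j≡i) = subst (λ j → crossings S x v j ≡ crossings S z v j) (sym j≡i)
                                           (column-agrees U rows i i∈U i-max v v∈U)
      by-position (no v≢i)  (no j≢i)  =
        crossings-agree k (U ─ i) (ℕP.≤-pred (subst (_≤ suc k) (size-─ U i∈U) size≤))
          (rows-without-max U rows i i∈U i-max) v j
          (trans (updateAt-minimal v i U v≢i) v∈U) (trans (updateAt-minimal j i U j≢i) j∈U)

  label≡⇒crossings≡ : (∀ i → label S x i ≡ label S z i) → ∀ v j → crossings S x v j ≡ crossings S z v j
  label≡⇒crossings≡ labels v j = crossings-agree n (λ _ → true) (ℕP.≤-reflexive (∑-const n)) rows v j refl refl
    where
    rows : RowSumsAgree (λ _ → true)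
    rows v _ = trans (sym (label≡∑crossings S x v)) (trans (labels v) (label≡∑crossings S z v))

  label-injective : Generic S x → Generic S z → (∀ i → label S x i ≡ label S z i) → SameRegion S x z
  label-injective gen-x gen-z labels = Crossings⊆⇒SameRegion S x z gen-x gen-z
    (λ a b → crossings≡⇒crossed S x z a b (agree a b))
    (λ a b → crossings≡⇒crossed S z x a b (sym (agree a b)))
    where
    agree : ∀ a b → crossings S x a b ≡ crossings S z a b
    agree = label≡⇒crossings≡ labels

-- Surjectivity

∈⇒≤sum : ∀ {m xs} → m ∈ xs → m ≤ sum xs
∈⇒≤sum {xs = x ∷ xs} (here refl) = ℕP.m≤m+n x (sum xs)
∈⇒≤sum {xs = x ∷ xs} (there m∈) = ℕP.≤-trans (∈⇒≤sum m∈) (ℕP.m≤n+m (sum xs) x)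

module _ {n : ℕ} (S : Family n) (B : ℕ) .{{_ : NonZero B}} where

  -- The label u would get at position y, the placed vertices W sitting at positions X; the
  -- hyperplane H_{u,w,s} then sits at X w + s * B.
  labelAt : (Fin n → Bool) → (Fin n → ℕ) → Fin n → ℕ → ℕ
  labelAt W X u y = ∑ (W ↾ λ w → count (λ s → X w + s * B <? y) (S⁺ S u w))

  Separated : (Fin n → Bool) → (Fin n → ℕ) → Set
  Separated W X = ∀ {w w′} → W w ≡ true → W w′ ≡ true → w ≢ w′ → ∀ s → X w + s * B ≢ X w′

  private
    shift : ∀ {a b s s′} → a + s * B ≡ b + s′ * B → s′ ≤ s → a + (s ∸ s′) * B ≡ b
    shift {a} {b} {s} {s′} eq s′≤s = ℕP.+-cancelʳ-≡ (s′ * B) _ _ (begin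
      a + (s ∸ s′) * B + s′ * B     ≡⟨ ℕP.+-assoc a _ _ ⟩
      a + ((s ∸ s′) * B + s′ * B)   ≡⟨ cong (λ k → a + k) (ℕP.*-distribʳ-+ B (s ∸ s′) s′) ⟨
      a + (s ∸ s′ + s′) * B         ≡⟨ cong (λ k → a + k * B) (ℕP.m∸n+n≡m s′≤s) ⟩
      a + s * B                     ≡⟨ eq ⟩
      b + s′ * B                    ∎)
      where open ≡-Reasoning

  separated-injective : ∀ {W X} → Separated W X → ∀ {w w′ s s′} → W w ≡ true → W w′ ≡ true →
    X w + s * B ≡ X w′ + s′ * B → w ≡ w′
  separated-injective {W} {X} sep {w} {w′} {s} {s′} w∈W w′∈W eq with w FinP.≟ w′ | ℕP.≤-total s′ s
  ... | yes w≡w′ | _         = w≡w′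
  ... | no w≢w′  | inj₁ s′≤s = ⊥-elim (sep w∈W w′∈W w≢w′ (s ∸ s′) (shift eq s′≤s))
  ... | no w≢w′  | inj₂ s≤s′ = ⊥-elim (sep w′∈W w∈W (w≢w′ ∘ sym) (s′ ∸ s) (shift (sym eq) s≤s′))

  labelAt-≤-arcsTo : ∀ W X u y → labelAt W X u y ≤ arcsTo S W u
  labelAt-≤-arcsTo W X u y = ∑-mono-≤ (↾-mono-≤ W (λ w _ → ListP.length-filter _ (S⁺ S u w)))

  labelAt-suc : ∀ {W X} → Separated W X → ∀ u y → labelAt W X u (suc y) ≤ suc (labelAt W X u y)
  labelAt-suc {W} {X} sep u y = begin
    labelAt W X u (suc y)                              ≤⟨ ∑-mono-≤ (↾-mono-≤ W (λ w _ → split w)) ⟩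
    ∑ (W ↾ λ w → below w + hits w)                     ≡⟨ ∑-cong (↾-+ W below hits) ⟩
    ∑ (λ w → (W ↾ below) w + (W ↾ hits) w)             ≡⟨ ∑-+ (W ↾ below) (W ↾ hits) ⟩
    labelAt W X u y + ∑ (W ↾ hits)                     ≤⟨ ℕP.+-monoʳ-≤ (labelAt W X u y) (∑-≤1 hits≤1 hits-unique) ⟩
    labelAt W X u y + 1                                ≡⟨ ℕP.+-comm _ 1 ⟩
    suc (labelAt W X u y)                              ∎
    where
    open ℕP.≤-Reasoning
    below hits : Fin n → ℕ
    below w = count (λ s → X w + s * B <? y) (S⁺ S u w)
    hits w = count (λ s → X w + s * B ≟ y) (S⁺ S u w)
    split : ∀ w → count (λ s → X w + s * B <? suc y) (S⁺ S u w) ≤ below w + hits w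
    split w = count-split _ _ _ {S⁺ S u w} (λ _ → ℕP.m<1+n⇒m<n∨m≡n)
    hits≤1 : ∀ w → (W ↾ hits) w ≤ 1
    hits≤1 w with W w
    ... | false = z≤n
    ... | true  = count-≤1 _ (S⁺-unique S u w) (λ {s} {s′} hit hit′ →
      ℕP.*-cancelʳ-≡ s s′ B (ℕP.+-cancelˡ-≡ (X w) _ _ (trans hit (sym hit′))))
    hit-at : ∀ w → 0 < (W ↾ hits) w → W w ≡ true × ∃[ s ] X w + s * B ≡ y
    hit-at w pos = let w∈W , pos′ = ↾-pos⇒∈ W hits pos
                       s , _ , hit = count-pos⇒∃ _ {S⁺ S u w} pos′
                   in w∈W , s , hit
    hits-unique : ∀ w w′ → 0 < (W ↾ hits) w → 0 < (W ↾ hits) w′ → w ≡ w′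
    hits-unique w w′ pos pos′ = let w∈W , s , hit = hit-at w pos ; w′∈W , s′ , hit′ = hit-at w′ pos′
                                in separated-injective {W} {X} sep {s = s} {s′} w∈W w′∈W (trans hit (sym hit′))

  labelAt-jump : ∀ W X u y → labelAt W X u y < labelAt W X u (suc y) →
    ∃₂ λ w s → W w ≡ true × X w + s * B ≡ y
  labelAt-jump W X u y lt =
    let w , lt-w = ∑<∑⇒∃< {f = W ↾ below y} {g = W ↾ below (suc y)} lt
        w∈W , lt-w′ = ↾-<⇒∈ W (below y) (below (suc y)) lt-w
        s , _ , ≮y , <suc-y = count<count⇒∃ (λ s → X w + s * B <? y) (λ s → X w + s * B <? suc y) {S⁺ S u w} lt-w′
    in w , s , w∈W , ℕP.≤-antisym (ℕP.≤-pred <suc-y) (ℕP.≮⇒≥ ≮y)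
    where
    below : ℕ → Fin n → ℕ
    below y w = count (λ s → X w + s * B <? y) (S⁺ S u w)

  reach : Fin n → ℕ
  reach u = ∑ (λ w → sum (S⁺ S u w)) * B

  labelAt-saturated : ∀ W X M u → (∀ {w} → W w ≡ true → X w ≤ M) →
    labelAt W X u (suc (M + reach u)) ≡ arcsTo S W u
  labelAt-saturated W X M u X≤M = ∑-cong (↾-cong W (λ w w∈W → count-all _ {S⁺ S u w} (λ s∈ →
    s≤s (ℕP.+-mono-≤ (X≤M w∈W) (ℕP.*-monoˡ-≤ B (ℕP.≤-trans (∈⇒≤sum s∈) (∑-term _ w)))))))

  labelAt-cong : ∀ W X X′ u y y′ → (∀ {w} → W w ≡ true → ∀ s → X w + s * B < y ⇔ X′ w + s * B < y′) →
    labelAt W X u y ≡ labelAt W X′ u y′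
  labelAt-cong W X X′ u y y′ same = ∑-cong (↾-cong W (λ w w∈W →
    count-cong _ _ {S⁺ S u w} (λ {s} _ → to (same w∈W s)) (λ {s} _ → from (same w∈W s))))

  labelAt-insert : ∀ W X u v y → W u ≡ false →
    labelAt (updateAt W u (const true)) X v y ≡ labelAt W X v y + count (λ s → X u + s * B <? y) (S⁺ S v u)
  labelAt-insert W X u v y u∉W =
    ∑↾-split (updateAt W u (const true)) W u _ (updateAt-updates u W) u∉W (λ j j≢u → updateAt-minimal j u W j≢u)

  latticePoint-crosses⇔ : ∀ (X : Fin n → ℕ) a b s → ℕ→ℚ s ℚ.< diff (latticePoint B X) a b ⇔ X b + s * B < X a
  latticePoint-crosses⇔ X a b = ℕ→ℚ<scaled⇔ (X a) (X b) (latticePoint-scaled B X a b)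

  label-latticePoint : ∀ (X : Fin n → ℕ) w → label S (latticePoint B X) w ≡ labelAt (const true) X w (X w)
  label-latticePoint X w = trans (label≡∑crossings S (latticePoint B X) w) (∑-cong λ j →
    count-cong (λ s → ℕ→ℚ s ℚP.<? diff (latticePoint B X) w j) (λ s → X j + s * B <? X w) {S⁺ S w j}
      (λ {s} _ → to (latticePoint-crosses⇔ X w j s)) (λ {s} _ → from (latticePoint-crosses⇔ X w j s)))

  latticePoint-generic : ∀ (X : Fin n → ℕ) → Separated (const true) X → Generic S (latticePoint B X)
  latticePoint-generic X sep i j i<j (+ s) _ on-H =
    sep refl refl (FinP.<⇒≢ i<j ∘ sym) s (scaled≡ℕ→ℚ⇒ (X i) (X j) (latticePoint-scaled B X i j) s on-H)
  latticePoint-generic X sep i j i<j -[1+ m ] _ on-H =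
    sep refl refl (FinP.<⇒≢ i<j) (suc m) (scaled≡ℕ→ℚ⇒ (X j) (X i) (latticePoint-scaled B X j i) (suc m) (begin
      diff (latticePoint B X) j i            ≡⟨ diff-antisym (latticePoint B X) i j ⟩
      ℚ.- diff (latticePoint B X) i j        ≡⟨ cong ℚ.-_ on-H ⟩
      ℚ.- ℤ→ℚ (ℤ.- + suc m)                  ≡⟨ cong ℚ.-_ (ℤ→ℚ-neg (+ suc m)) ⟩
      ℚ.- (ℚ.- ℕ→ℚ (suc m))                  ≡⟨ neg-involutive (ℕ→ℚ (suc m)) ⟩
      ℕ→ℚ (suc m)                            ∎))
    where open ≡-Reasoning

multiples-gap : ∀ {d a b} → d ∣ a → d ∣ b → a < b → a + d ≤ b
multiples-gap {d} (divides qa refl) (divides qb refl) qa*d<qb*d =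
  ℕP.≤-trans (ℕP.≤-reflexive (ℕP.+-comm (qa * d) d)) (ℕP.*-monoˡ-≤ d (ℕP.≰⇒> qb≰qa))
  where
  qb≰qa : ¬ qb ≤ qa
  qb≰qa qb≤qa = ℕP.<⇒≱ qa*d<qb*d (ℕP.*-monoˡ-≤ d qb≤qa)

no-multiple-in-gap : ∀ e {τ a} → 2 ^ suc e ∣ τ → 2 ^ suc e ∣ a → a ≤ τ + 2 ^ e → a ≤ τ
no-multiple-in-gap e {τ} {a} 2^e∣τ 2^e∣a a≤ = ℕP.≮⇒≥ (λ τ<a → ℕP.<⇒≱
  (ℕP.+-monoʳ-< τ 2^e<2^suc-e) (ℕP.≤-trans (multiples-gap 2^e∣τ 2^e∣a τ<a) a≤))
  where
  2^e<2^suc-e : 2 ^ e < 2 ^ suc e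
  2^e<2^suc-e = ℕP.m<m+n (2 ^ e) (ℕP.≤-trans (ℕP.m^n>0 2 e) (ℕP.m≤m+n (2 ^ e) 0))

2^∣2^ : ∀ {e n} → e ≤ n → 2 ^ e ∣ 2 ^ n
2^∣2^ {e} e≤n with ℕP.m≤n⇒∃[o]m+o≡n e≤n
... | k , refl = subst (2 ^ e ∣_) (sym (ℕP.^-distribˡ-+-* 2 e k)) (m∣m*n (2 ^ k))

module _ {n : ℕ} (S : Family n) (p : Fin n → ℕ) where

  private
    B : ℕ
    B = 2 ^ n

    instance
      B≢0 : NonZero B
      B≢0 = ℕP.m^n≢0 2 n

  Ready : (Fin n → Bool) → (Fin n → ℕ) → ℕ → Fin n → Set
  Ready W X t u = W u ≡ false × p u ≤ arcsTo S W u × p u ≤ labelAt S B W X u (suc t)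

  ready? : ∀ W X t → Decidable (Ready W X t)
  ready? W X t u = (W u Bool.≟ false) ×-dec (p u ≤? arcsTo S W u) ×-dec (p u ≤? labelAt S B W X u (suc t))

  unready⇒below : ∀ W X t {u} → W u ≡ false → ¬ Ready W X t u → labelAt S B W X u (suc t) < p u
  unready⇒below W X t {u} u∉W unready with p u ≤? arcsTo S W u
  ... | yes p≤arcs = ℕP.≰⇒> (λ p≤label → unready (u∉W , p≤arcs , p≤label))
  ... | no p≰arcs  = ℕP.≤-<-trans (labelAt-≤-arcsTo S B W X u (suc t)) (ℕP.≰⇒> p≰arcs)

  -- While at most e vertices remain unplaced, all positions and the frontier M are multiples of
  -- 2^e, so the next vertex, placed at τ + 2^(e-1) with τ a multiple of 2^e, avoids every
  -- hyperplane of the placed ones.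
  record Invariant (e : ℕ) (W : Fin n → Bool) (X : Fin n → ℕ) (M : ℕ) : Set where
    field
      unplaced≤e     : size (not ∘ W) ≤ e
      e≤n            : e ≤ n
      2^e∣X          : ∀ {w} → W w ≡ true → 2 ^ e ∣ X w
      2^e∣M          : 2 ^ e ∣ M
      X≤M            : ∀ {w} → W w ≡ true → X w ≤ M
      separated      : Separated S B W X
      placed-label   : ∀ {w} → W w ≡ true → labelAt S B W X w (X w) ≡ p w
      unplaced-label : ∀ {u} → W u ≡ false → labelAt S B W X u (suc M) ≤ p u

  initial : Invariant n (const false) (const 0) 0
  initial = record
    { unplaced≤e     = ℕP.≤-reflexive (∑-const n)
    ; e≤n            = ℕP.≤-refl
    ; 2^e∣X          = λ ()
    ; 2^e∣M          = (2 ^ n) ∣0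
    ; X≤M            = λ ()
    ; separated      = λ ()
    ; placed-label   = λ ()
    ; unplaced-label = λ _ → ℕP.≤-trans (ℕP.≤-reflexive (∑-zero {n} (λ _ → refl))) z≤n
    }

  below-first-ready : ∀ {W X M τ} → M < τ → (∀ {t} → M ≤ t → t < τ → ¬ ∃ (Ready W X t)) →
    ∀ {u} → W u ≡ false → labelAt S B W X u τ < p u
  below-first-ready {W} {X} {τ = suc t} (s≤s M≤t) none-before u∉W =
    unready⇒below W X t u∉W (λ ready → none-before M≤t ℕP.≤-refl (_ , ready))

  -- τ is the first position at which some unplaced vertex has collected its label. Taking the
  -- largest such u keeps the labels of the other ready u′ < u unchanged, since 0 ∉ S⁺_{u′,u}.
  record NextVertex (W : Fin n → Bool) (X : Fin n → ℕ) (M : ℕ) : Set where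
    field
      τ           : ℕ
      u           : Fin n
      M≤τ         : M ≤ τ
      none-before : ∀ {t} → M ≤ t → t < τ → ¬ ∃ (Ready W X t)
      u-ready     : Ready W X τ u
      u-latest    : ∀ {u′} → Ready W X τ u′ → toℕ u′ ≤ toℕ u

  next-vertex : Park S p → ∀ {W X M} → (∀ {w} → W w ≡ true → X w ≤ M) →
    ∃[ u ] W u ≡ false → NextVertex W X M
  next-vertex park {W} {X} {M} X≤M unplaced-exists with park-unplaced S park W unplaced-exists
  ... | u₁ , u₁∉W , p≤arcs = from-first
    (least (λ t → FinP.any? (ready? W X t)) M (reach S B u₁) (u₁ , u₁∉W , p≤arcs , p≤label))
    where
    p≤label : p u₁ ≤ labelAt S B W X u₁ (suc (M + reach S B u₁))
    p≤label = ℕP.≤-trans p≤arcs (ℕP.≤-reflexive (sym (labelAt-saturated S B W X M u₁ X≤M)))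
    from-first : ∃[ τ ] (M ≤ τ × ∃ (Ready W X τ) × ∀ {t} → M ≤ t → t < τ → ¬ ∃ (Ready W X t)) →
      NextVertex W X M
    from-first (τ , M≤τ , some-ready , none-before) with
      argmin (λ a b → b ≤ a) (λ a b → ℕP.≤-total b a) (λ a≥b b≥c → ℕP.≤-trans b≥c a≥b) (ready? W X τ) toℕ some-ready
    ... | u , u-ready , u-latest = record
      { τ = τ ; u = u ; M≤τ = M≤τ ; none-before = none-before ; u-ready = u-ready ; u-latest = u-latest }

  module Place {e W X M} (inv : Invariant (suc e) W X M) (next : NextVertex W X M) where
    open Invariant inv
    open NextVertex next

    u∉W : W u ≡ false
    u∉W = proj₁ u-ready

    ready-bounded : ∀ {u′} → Ready W X τ u′ → labelAt S B W X u′ (suc τ) ≤ p u′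
    ready-bounded {u′} (u′∉W , _) = [ after-M , at-M ]′ (ℕP.m≤n⇒m<n∨m≡n M≤τ)
      where
      at-M : M ≡ τ → labelAt S B W X u′ (suc τ) ≤ p u′
      at-M M≡τ = subst (λ t → labelAt S B W X u′ (suc t) ≤ p u′) M≡τ (unplaced-label u′∉W)
      after-M : M < τ → labelAt S B W X u′ (suc τ) ≤ p u′
      after-M M<τ = ℕP.≤-trans (labelAt-suc S B separated u′ τ) (below-first-ready M<τ none-before u′∉W)

    label-u : labelAt S B W X u (suc τ) ≡ p u
    label-u = ℕP.≤-antisym (ready-bounded u-ready) (proj₂ (proj₂ u-ready))

    jump-divisible : ∀ {w} → W w ≡ true → ∀ s → 2 ^ suc e ∣ X w + s * B
    jump-divisible w∈W s = ∣m∣n⇒∣m+n (2^e∣X w∈W) (∣-trans (2^∣2^ e≤n) (n∣m*n s))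

    2^suc-e∣τ : 2 ^ suc e ∣ τ
    2^suc-e∣τ = [ at-jump , (λ M≡τ → subst (2 ^ suc e ∣_) M≡τ 2^e∣M) ]′ (ℕP.m≤n⇒m<n∨m≡n M≤τ)
      where
      at-jump : M < τ → 2 ^ suc e ∣ τ
      at-jump M<τ =
        let w , s , w∈W , jump = labelAt-jump S B W X u τ
              (ℕP.<-≤-trans (below-first-ready M<τ none-before u∉W) (ℕP.≤-reflexive (sym label-u)))
        in subst (2 ^ suc e ∣_) jump (jump-divisible w∈W s)

    Xu : ℕ
    Xu = τ + 2 ^ e

    τ<Xu : τ < Xu
    τ<Xu = ℕP.m<m+n τ (ℕP.m^n>0 2 e)

    jump≤Xu⇒≤τ : ∀ {w} → W w ≡ true → ∀ s → X w + s * B ≤ Xu → X w + s * B ≤ τ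
    jump≤Xu⇒≤τ w∈W s = no-multiple-in-gap e 2^suc-e∣τ (jump-divisible w∈W s)

    W′ : Fin n → Bool
    W′ = updateAt W u (const true)

    X′ : Fin n → ℕ
    X′ = updateAt X u (const Xu)

    placed≢u : ∀ {w} → W w ≡ true → w ≢ u
    placed≢u w∈W refl with trans (sym w∈W) u∉W
    ... | ()

    X′-placed : ∀ {w} → W w ≡ true → X′ w ≡ X w
    X′-placed {w} w∈W = updateAt-minimal w u X (placed≢u w∈W)

    placed′ : ∀ {w} → W′ w ≡ true → w ≡ u ⊎ W w ≡ true
    placed′ {w} w∈W′ with w FinP.≟ u
    ... | yes w≡u = inj₁ w≡u
    ... | no w≢u  = inj₂ (trans (sym (updateAt-minimal w u W w≢u)) w∈W′)

    unplaced′ : ∀ {w} → W′ w ≡ false → W w ≡ false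
    unplaced′ {w} w∉W′ with w FinP.≟ u
    ... | yes refl with trans (sym (updateAt-updates u W)) w∉W′
    ...   | ()
    unplaced′ {w} w∉W′ | no w≢u = trans (sym (updateAt-minimal w u W w≢u)) w∉W′

    labelAt-W′ : ∀ v y → labelAt S B W′ X′ v y ≡ labelAt S B W X′ v y + count (λ s → Xu + s * B <? y) (S⁺ S v u)
    labelAt-W′ v y = trans (labelAt-insert S B W X′ u v y u∉W)
      (cong (λ x → labelAt S B W X′ v y + count (λ s → x + s * B <? y) (S⁺ S v u)) (updateAt-updates u {const Xu} X))

    labelAt-X′ : ∀ v y y′ → (∀ {w} → W w ≡ true → ∀ s → X w + s * B < y ⇔ X w + s * B < y′) →
      labelAt S B W X′ v y ≡ labelAt S B W X v y′
    labelAt-X′ v y y′ same = labelAt-cong S B W X′ X v y y′ (λ {w} w∈W s →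
      subst (λ x → (x + s * B < y) ⇔ (X w + s * B < y′)) (sym (X′-placed w∈W)) (same w∈W s))

    jump<Xu⇔ : ∀ {w} → W w ≡ true → ∀ s → X w + s * B < Xu ⇔ X w + s * B < suc τ
    jump<Xu⇔ w∈W s = mk⇔ (λ lt → s≤s (jump≤Xu⇒≤τ w∈W s (ℕP.<⇒≤ lt))) (λ lt → ℕP.<-≤-trans lt τ<Xu)

    jump<suc-Xu⇔ : ∀ {w} → W w ≡ true → ∀ s → X w + s * B < suc Xu ⇔ X w + s * B < suc τ
    jump<suc-Xu⇔ w∈W s = mk⇔ (λ lt → s≤s (jump≤Xu⇒≤τ w∈W s (ℕP.≤-pred lt))) (λ lt → ℕP.<-trans lt (s≤s τ<Xu))

    2^e∣Xu : 2 ^ e ∣ Xu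
    2^e∣Xu = ∣m∣n⇒∣m+n (∣-trans (n∣m*n 2) 2^suc-e∣τ) ∣-refl

    X<Xu : ∀ {w} → W w ≡ true → X w < Xu
    X<Xu w∈W = ℕP.≤-<-trans (ℕP.≤-trans (X≤M w∈W) M≤τ) τ<Xu

    new-crossings : Fin n → ℕ
    new-crossings v = count (λ s → Xu + s * B <? suc Xu) (S⁺ S v u)

    new-crossing⇒0 : ∀ {s} → Xu + s * B < suc Xu → s ≡ 0
    new-crossing⇒0 {s} lt = ℕP.m*n≡0⇒m≡0 s B (ℕP.n≤0⇒n≡0
      (ℕP.+-cancelˡ-≤ Xu (s * B) 0 (subst (Xu + s * B ≤_) (sym (ℕP.+-identityʳ Xu)) (ℕP.≤-pred lt))))

    new-crossings≤1 : ∀ v → new-crossings v ≤ 1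
    new-crossings≤1 v = count-≤1 _ (S⁺-unique S v u) (λ lt lt′ → trans (new-crossing⇒0 lt) (sym (new-crossing⇒0 lt′)))

    new-crossings≡0 : ∀ v → ¬ 0 ∈S⁺[ S , v , u ] → new-crossings v ≡ 0
    new-crossings≡0 v 0∉ = count-none _ {S⁺ S v u} (λ s∈ lt → 0∉ (subst (_∈S⁺[ S , v , u ]) (new-crossing⇒0 lt) s∈))

    unplaced≤e′ : size (not ∘ W′) ≤ e
    unplaced≤e′ = ℕP.≤-pred (subst (_≤ suc e) size≡ unplaced≤e)
      where
      size≡ : size (not ∘ W) ≡ suc (size (not ∘ W′))
      size≡ = trans (∑↾-split (not ∘ W) (not ∘ W′) u (λ _ → 1) (cong not u∉W) (cong not (updateAt-updates u W))
                       (λ j j≢u → cong not (sym (updateAt-minimal j u W j≢u))))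
                    (ℕP.+-comm _ 1)

    2^e∣X′ : ∀ {w} → W′ w ≡ true → 2 ^ e ∣ X′ w
    2^e∣X′ {w} w∈W′ with placed′ w∈W′
    ... | inj₁ refl = subst (2 ^ e ∣_) (sym (updateAt-updates u {const Xu} X)) 2^e∣Xu
    ... | inj₂ w∈W  = subst (2 ^ e ∣_) (sym (X′-placed w∈W)) (∣-trans (n∣m*n 2) (2^e∣X w∈W))

    X′≤Xu : ∀ {w} → W′ w ≡ true → X′ w ≤ Xu
    X′≤Xu {w} w∈W′ with placed′ w∈W′
    ... | inj₁ refl = ℕP.≤-reflexive (updateAt-updates u {const Xu} X)
    ... | inj₂ w∈W  = subst (_≤ Xu) (sym (X′-placed w∈W)) (ℕP.<⇒≤ (X<Xu w∈W))

    separated′ : Separated S B W′ X′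
    separated′ {w} {w′} w∈W′ w′∈W′ w≢w′ s with placed′ w∈W′ | placed′ w′∈W′
    ... | inj₁ refl | inj₁ refl = ⊥-elim (w≢w′ refl)
    ... | inj₁ refl | inj₂ w′∈W rewrite updateAt-updates u {const Xu} X | X′-placed w′∈W =
      λ eq → ℕP.<-irrefl (sym eq) (ℕP.<-≤-trans (X<Xu w′∈W) (ℕP.m≤m+n Xu (s * B)))
    ... | inj₂ w∈W | inj₁ refl rewrite updateAt-updates u {const Xu} X | X′-placed w∈W =
      λ eq → ℕP.<-irrefl eq (ℕP.≤-<-trans (jump≤Xu⇒≤τ w∈W s (ℕP.≤-reflexive eq)) τ<Xu)
    ... | inj₂ w∈W | inj₂ w′∈W rewrite X′-placed w∈W | X′-placed w′∈W = separated w∈W w′∈W w≢w′ s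

    placed-label′ : ∀ {w} → W′ w ≡ true → labelAt S B W′ X′ w (X′ w) ≡ p w
    placed-label′ {w} w∈W′ with placed′ w∈W′
    ... | inj₁ refl = begin
      labelAt S B W′ X′ u (X′ u)
        ≡⟨ cong (labelAt S B W′ X′ u) (updateAt-updates u {const Xu} X) ⟩
      labelAt S B W′ X′ u Xu                                        ≡⟨ labelAt-W′ u Xu ⟩
      labelAt S B W X′ u Xu + count (λ s → Xu + s * B <? Xu) (S⁺ S u u)
        ≡⟨ cong₂ _+_ (labelAt-X′ u Xu (suc τ) jump<Xu⇔) (count-none _ {S⁺ S u u} (λ s∈ _ → ∉S⁺-diag S u s∈)) ⟩
      labelAt S B W X u (suc τ) + 0                                 ≡⟨ ℕP.+-identityʳ _ ⟩
      labelAt S B W X u (suc τ)                                     ≡⟨ label-u ⟩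
      p u                                                           ∎
      where open ≡-Reasoning
    ... | inj₂ w∈W = begin
      labelAt S B W′ X′ w (X′ w)                                    ≡⟨ cong (labelAt S B W′ X′ w) (X′-placed w∈W) ⟩
      labelAt S B W′ X′ w (X w)                                     ≡⟨ labelAt-W′ w (X w) ⟩
      labelAt S B W X′ w (X w) + count (λ s → Xu + s * B <? X w) (S⁺ S w u)
        ≡⟨ cong₂ _+_ (labelAt-X′ w (X w) (X w) (λ _ _ → mk⇔ id id)) (count-none _ {S⁺ S w u} (λ _ lt →
             ℕP.<-asym (X<Xu w∈W) (ℕP.≤-<-trans (ℕP.m≤m+n Xu _) lt))) ⟩
      labelAt S B W X w (X w) + 0                                   ≡⟨ ℕP.+-identityʳ _ ⟩
      labelAt S B W X w (X w)                                       ≡⟨ placed-label w∈W ⟩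
      p w                                                           ∎
      where open ≡-Reasoning

    unplaced-label′ : ∀ {v} → W′ v ≡ false → labelAt S B W′ X′ v (suc Xu) ≤ p v
    unplaced-label′ {v} v∉W′ = subst (_≤ p v) (sym label≡) (by-readiness (ready? W X τ v))
      where
      v∉W : W v ≡ false
      v∉W = unplaced′ v∉W′
      label≡ : labelAt S B W′ X′ v (suc Xu) ≡ labelAt S B W X v (suc τ) + new-crossings v
      label≡ = trans (labelAt-W′ v (suc Xu)) (cong (_+ new-crossings v) (labelAt-X′ v (suc Xu) (suc τ) jump<suc-Xu⇔))
      by-readiness : Dec (Ready W X τ v) → labelAt S B W X v (suc τ) + new-crossings v ≤ p v
      by-readiness (yes ready) = subst (_≤ p v)
        (sym (trans (cong (_+_ (labelAt S B W X v (suc τ))) (new-crossings≡0 v (λ 0∈ →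
          ℕP.<-irrefl refl (ℕP.<-≤-trans (0∈S⁺⇒> S 0∈) (u-latest ready))))) (ℕP.+-identityʳ _)))
        (ready-bounded ready)
      by-readiness (no unready) = ℕP.≤-trans (ℕP.+-monoʳ-≤ _ (new-crossings≤1 v))
        (subst (_≤ p v) (ℕP.+-comm 1 _) (unready⇒below W X τ v∉W unready))

    invariant′ : Invariant e W′ X′ Xu
    invariant′ = record
      { unplaced≤e     = unplaced≤e′
      ; e≤n            = ℕP.≤-trans (ℕP.n≤1+n e) e≤n
      ; 2^e∣X          = 2^e∣X′
      ; 2^e∣M          = 2^e∣Xu
      ; X≤M            = X′≤Xu
      ; separated      = separated′
      ; placed-label   = placed-label′
      ; unplaced-label = unplaced-label′
      }

  place-all : Park S p → ∀ e W X M → Invariant e W X M →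
    ∃[ X ] (Separated S B (const true) X × ∀ w → labelAt S B (const true) X w (X w) ≡ p w)
  place-all park e W X M inv with FinP.any? (λ u → W u Bool.≟ false)
  ... | no nothing-unplaced = X , (λ {w} {w′} _ _ → separated (placed w) (placed w′)) ,
                              (λ w → trans (labelAt-all w (X w)) (placed-label (placed w)))
    where
    open Invariant inv
    placed : ∀ w → W w ≡ true
    placed w = ¬-not (λ w∉W → nothing-unplaced (w , w∉W))
    labelAt-all : ∀ w y → labelAt S B (const true) X w y ≡ labelAt S B W X w y
    labelAt-all w y = ∑-cong (λ j → sym (↾-true W (λ j → count (λ s → X j + s * B <? y) (S⁺ S w j)) (placed j)))
  place-all park zero W X M inv | yes (u₀ , u₀∉W) =
    ⊥-elim (ℕP.n≮0 (subst (_≤ 0) (size-─ (not ∘ W) (cong not u₀∉W)) (Invariant.unplaced≤e inv)))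
  place-all park (suc e) W X M inv | yes unplaced =
    place-all park e _ _ _ (Place.invariant′ inv (next-vertex park (Invariant.X≤M inv) unplaced))

  label-surjective : Park S p → ∃[ x ] (Generic S x × ∀ i → label S x i ≡ p i)
  label-surjective park =
    let X , separated , labels = place-all park n (const false) (const 0) 0 initial
    in latticePoint B X , latticePoint-generic S B X separated , λ i → trans (label-latticePoint S B X i) (labels i)

corollary4p7 : ∀ (n : ℕ) → 1 ≤ n → (S : Family n) →
    PropertyX S → PropertyY S →
    -- λ is a well-defined map R(A_S) → Park_S
    (∀ (x y : Point n) → Generic S x → Generic S y → SameRegion S x y →
       ∀ i → label S x i ≡ label S y i)
    × (∀ (x : Point n) → Generic S x → Park S (label S x))
    -- injective
    × (∀ (x y : Point n) → Generic S x → Generic S y →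
       (∀ i → label S x i ≡ label S y i) → SameRegion S x y)
    -- surjective
    × (∀ (p : Fin n → ℕ) → Park S p →
       ∃[ x ] (Generic S x × (∀ i → label S x i ≡ p i)))
corollary4p7 n _ S propX propY =
  (λ x y gen-x gen-y same → label-cong S x y gen-x gen-y same) ,
  (λ x _ → label-park S x) ,
  (λ x y gen-x gen-y → label-injective S propX propY x y gen-x gen-y) ,
  (λ p park → label-surjective S p park)
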